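{- Let $\Gamma$ be an $\mathbf{F}_2^\mu$ environment, $e$ a Curry-style evidence and $T$ a type, where all types involved are well-kinded, of the form described below, and contain no existential variables. If $\{(\Gamma, e, T)\} \longrightarrow^* \emptyset$ by resolution by second-order matching (RSM), then there exists an evidence $e'$ such that $\Gamma \vdash e' : T$ in $\mathbf{F}_2^\mu$ and $|e'| = e$.
   Context: System $\mathbf{F}_2^\mu$: evidence $e ::= \alpha \mid \kappa \mid \lambda\alpha.e \mid e\,e' \mid \mu\alpha.e \mid e\,T \mid \lambda x.e$; term kinds $K::=*\mid*\Rightarrow K$; types $T ::= F \mid x \mid \lambda x.T \mid \forall x{:}K.T \mid T\,T' \mid T \Rightarrow T'$, required to be well-kinded (a type $\lambda x.T$ must have $x\in\mathrm{FV}(T)$, applications $T_2T_1$ need $T_1:*$, $T_2:*\Rightarrow K$, and $\forall$, $\Rightarrow$ form types of kind $o$). Typing rules: declared variables/constants; (App) from $e_1:T'$, $e_2:T'\Rightarrow T$ infer $e_2e_1:T$; (Lam) from $\Gamma,\alpha:T'\vdash e:T$ infer $\lambda\alpha.e:T'\Rightarrow T$; (Mu) from $\Gamma,\alpha:T\vdash e:T$ infer $\mu\alpha.e:T$; (Inst) from $e:\forall x{:}K.T$ infer $e\,T':[T'/x]T$; (Abs) from $e:T$, $x\notin\mathrm{FV}(\Gamma)$ infer $\lambda x.e:\forall x{:}K.T$; (Conv) types up to $\leftrightarrow_o^*$, $\to_o$ the compatible closure of $(\lambda x.T)T'\to_o[T'/x]T$. Erasure $|\cdot|$ deletes type abstractions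 $\lambda x.$ and type applications $e\,T$; a Curry-style evidence is one of the form $|e|$, i.e. built from $\alpha,\kappa,\lambda\alpha.e,e\,e',\mu\alpha.e$. Types are considered in the form $T ::= A \mid \forall\underline{x}.\,T_1\Rightarrow\cdots\Rightarrow T_n\Rightarrow A$ where $A$ has kind $*$ (the head). For $T=\forall x_1\ldots x_m.\,T_1,\ldots,T_n\Rightarrow A$, the existential variables are the $x_i$ not free in $A$ together with the free variables of $T$. Second-order matching of $A\mapsto B$ transforms sets of problems: $\{F\,\underline{A}\mapsto G\,\underline{B},E\}$ with distinct constants $F\neq G$ fails; $\{a\,A_1\ldots A_n\mapsto a\,B_1\ldots B_n,E\}$ becomes $\{A_1\mapsto B_1,\ldots,A_n\mapsto B_n,E\}$; for a variable $y$ and problem set $E'=\{y\,A_1\ldots A_n\mapsto a\,B_1\ldots B_m,E\}$ one may apply (Proj) $[\lambda x_1\ldots\lambda x_n.x_i/y]E'$ or (Imi) $[\lambda x_1\ldots\lambda x_n.\,a\,(y_1\underline{x})\cdots(y_m\underline{x})/y]E'$ with fresh $y_j$; $B\mapsto_\sigma A$ means some derivation reaches $\emptyset$ with accumulated substitution $\sigma$, restricted to well-kinded substitutions. RSM transforms finite sets $\Phi$ of triples $(\Gamma,e,T)$: (1) $\{(\Gamma,h\,e_1\cdots e_n,A),\Phi\}\longrightarrow\{(\Gamma,e_1,\sigma T_1),\ldots,(\Gamma,e_n,\sigma T_n),\Phi\}$ if $h$ is an evidence variable or constant with $h:\forall\underline{x}.\,T_1,\ldots,T_n\Rightarrow B\in\Gamma$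 (bound variables renamed fresh) and $B\mapsto_\sigma A$ ($n\ge0$); (2) $\{(\Gamma,\lambda\alpha_1\ldots\lambda\alpha_n.e,\ T_1,\ldots,T_n\Rightarrow A),\Phi\}\longrightarrow\{(\Gamma,\alpha_1:T_1,\ldots,\alpha_n:T_n,\ e,A),\Phi\}$ ($n\ge1$); (3) $\{(\Gamma,e,\forall x_1\ldots x_n.T),\Phi\}\longrightarrow\{(\Gamma,e,T),\Phi\}$ ($n\ge1$, the $x_i$ becoming fresh eigenvariables treated as constants); (4) $\{(\Gamma,\mu\alpha.e,T),\Phi\}\longrightarrow\{(\Gamma,\alpha:T,\ e,T),\Phi\}$. -}

module Defs where

open import Data.Nat using (ℕ; zero; suc; _∸_; _<_; _≤_; _≟_; _<?_)
open import Data.Fin using (Fin; toℕ)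
open import Data.List using (List; []; _∷_; _++_; map; length; zip; concatMap; reverse; foldl)
open import Data.List.Membership.Propositional using (_∈_; _∉_)
open import Data.List.Relation.Unary.All using (All)
open import Data.List.Relation.Unary.Unique.Propositional using (Unique)
open import Data.Maybe using (Maybe; just; nothing)
open import Data.Product using (_×_; _,_; ∃; proj₁; proj₂)
open import Data.Sum using (_⊎_)
open import Relation.Binary.PropositionalEquality using (_≡_; _≢_)
open import Relation.Nullary using (yes; no)
open import Relation.Binary.Construct.Closure.Equivalence using (EqClosure)
open import Relation.Binary.Construct.Closure.ReflexiveTransitive using (Star)

-- Kinds.  Term kinds K ::= * | * ⇒ K ; sorts add the kind o of ∀/⇒ types.

data Kind : Set where
  ⋆   : Kind
  ⋆⇒_ : Kind → Kind

data Sort : Set where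
  tk : Kind → Sort
  o  : Sort

-- sorts allowed for "types" (atoms of kind *, or ∀ / ⇒ types of kind o)
data IsProp : Sort → Set where
  prop⋆ : IsProp (tk ⋆)
  propo : IsProp o

-- Types, locally nameless: bound type variables are de Bruijn indices
-- (bv), free type variables are names (fv) annotated with their kind.

data Ty : Set where
  con : ℕ → Ty
  fv  : ℕ → Kind → Ty
  bv  : ℕ → Ty
  lam : Ty → Ty
  all : Kind → Ty → Ty
  app : Ty → Ty → Ty
  _⇒_ : Ty → Ty → Ty

infixr 5 _⇒_

shift : ℕ → Ty → Ty
shift c (con F) = con F
shift c (fv x K) = fv x K
shift c (bv i) with i <? c
... | yes _ = bv i
... | no _  = bv (suc i)
shift c (lam T) = lam (shift (suc c) T)
shift c (all K T) = all K (shift (suc c) T)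
shift c (app T U) = app (shift c T) (shift c U)
shift c (T ⇒ U) = shift c T ⇒ shift c U

-- substAt k U T : replace index k by U (U already shifted for depth k),
-- decrementing larger indices
substAt : ℕ → Ty → Ty → Ty
substAt k U (con F) = con F
substAt k U (fv x K) = fv x K
substAt k U (bv i) with i <? k
... | yes _ = bv i
... | no _ with i ≟ k
...   | yes _ = U
...   | no _ = bv (i ∸ 1)
substAt k U (lam T) = lam (substAt (suc k) (shift 0 U) T)
substAt k U (all K T) = all K (substAt (suc k) (shift 0 U) T)
substAt k U (app T T') = app (substAt k U T) (substAt k U T')
substAt k U (T ⇒ T') = substAt k U T ⇒ substAt k U T'

subst0 : Ty → Ty → Ty
subst0 U T = substAt 0 U T

substFv : ℕ → Ty → Ty → Ty
substFv x U (con F) = con F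
substFv x U (fv y K) with x ≟ y
... | yes _ = U
... | no _  = fv y K
substFv x U (bv i) = bv i
substFv x U (lam T) = lam (substFv x (shift 0 U) T)
substFv x U (all K T) = all K (substFv x (shift 0 U) T)
substFv x U (app T T') = app (substFv x U T) (substFv x U T')
substFv x U (T ⇒ T') = substFv x U T ⇒ substFv x U T'

names : Ty → List ℕ
names (con F) = []
names (fv x K) = x ∷ []
names (bv i) = []
names (lam T) = names T
names (all K T) = names T
names (app T U) = names T ++ names U
names (T ⇒ U) = names T ++ names U

data Occ : ℕ → Ty → Set where
  here  : ∀ {k} → Occ k (bv k)
  lam   : ∀ {k T} → Occ (suc k) T → Occ k (lam T)
  all   : ∀ {k K T} → Occ (suc k) T → Occ k (all K T)
  appˡ  : ∀ {k T U} → Occ k T → Occ k (app T U)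
  appʳ  : ∀ {k T U} → Occ k U → Occ k (app T U)
  arrˡ  : ∀ {k T U} → Occ k T → Occ k (T ⇒ U)
  arrʳ  : ∀ {k T U} → Occ k U → Occ k (T ⇒ U)

-- Kinding.  A signature assigns a term kind to every type constant;
-- Ψ lists the kinds of the bound indices in scope.

Sig : Set
Sig = ℕ → Kind

lookupK : List Kind → ℕ → Maybe Kind
lookupK [] i = nothing
lookupK (K ∷ Ψ) zero = just K
lookupK (K ∷ Ψ) (suc i) = lookupK Ψ i

data _︔_⊢_∶_ (sg : Sig) : List Kind → Ty → Sort → Set where
  k-con : ∀ {Ψ F} → sg ︔ Ψ ⊢ con F ∶ tk (sg F)
  k-fv  : ∀ {Ψ x K} → sg ︔ Ψ ⊢ fv x K ∶ tk K
  k-bv  : ∀ {Ψ i K} → lookupK Ψ i ≡ just K → sg ︔ Ψ ⊢ bv i ∶ tk K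
  k-lam : ∀ {Ψ T K} → sg ︔ (⋆ ∷ Ψ) ⊢ T ∶ tk K → Occ 0 T →
          sg ︔ Ψ ⊢ lam T ∶ tk (⋆⇒ K)
  k-all : ∀ {Ψ K T S} → sg ︔ (K ∷ Ψ) ⊢ T ∶ S → IsProp S →
          sg ︔ Ψ ⊢ all K T ∶ o
  k-app : ∀ {Ψ T₂ T₁ K} → sg ︔ Ψ ⊢ T₂ ∶ tk (⋆⇒ K) → sg ︔ Ψ ⊢ T₁ ∶ tk ⋆ →
          sg ︔ Ψ ⊢ app T₂ T₁ ∶ tk K
  k-arr : ∀ {Ψ T₁ T₂ S₁ S₂} → sg ︔ Ψ ⊢ T₁ ∶ S₁ → IsProp S₁ →
          sg ︔ Ψ ⊢ T₂ ∶ S₂ → IsProp S₂ → sg ︔ Ψ ⊢ T₁ ⇒ T₂ ∶ o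

WK : Sig → Ty → Set
WK sg T = ∃ λ S → sg ︔ [] ⊢ T ∶ S

WKType : Sig → Ty → Set
WKType sg T = ∃ λ S → IsProp S × sg ︔ [] ⊢ T ∶ S

data _→o_ : Ty → Ty → Set where
  β     : ∀ {T U} → app (lam T) U →o subst0 U T
  c-lam : ∀ {T T'} → T →o T' → lam T →o lam T'
  c-all : ∀ {K T T'} → T →o T' → all K T →o all K T'
  c-appˡ : ∀ {T T' U} → T →o T' → app T U →o app T' U
  c-appʳ : ∀ {T U U'} → U →o U' → app T U →o app T U'
  c-arrˡ : ∀ {T T' U} → T →o T' → (T ⇒ U) →o (T' ⇒ U)
  c-arrʳ : ∀ {T U U'} → U →o U' → (T ⇒ U) →o (T ⇒ U')

_↔o*_ : Ty → Ty → Set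
_↔o*_ = EqClosure _→o_

-- Shapes of types: T ::= A | ∀x̲. T₁ ⇒ ⋯ ⇒ Tₙ ⇒ A  (A an atom)

data Atom : Ty → Set where
  a-con : ∀ {F} → Atom (con F)
  a-fv  : ∀ {x K} → Atom (fv x K)
  a-bv  : ∀ {i} → Atom (bv i)
  a-lam : ∀ {T} → Atom (lam T)
  a-app : ∀ {T U} → Atom (app T U)

mutual
  data Chain : Ty → Set where
    c-atom : ∀ {A} → Atom A → Chain A
    c-arr  : ∀ {T₁ T₂} → Form T₁ → Chain T₂ → Chain (T₁ ⇒ T₂)

  data Form : Ty → Set where
    f-chain : ∀ {T} → Chain T → Form T
    f-all   : ∀ {K T} → Form T → Form (all K T)

alls : List Kind → Ty → Ty
alls [] T = T
alls (K ∷ Ks) T = all K (alls Ks T)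

arrows : List Ty → Ty → Ty
arrows [] A = A
arrows (T ∷ Ts) A = T ⇒ arrows Ts A

prefixLen : Ty → ℕ
prefixLen (all K T) = suc (prefixLen T)
prefixLen _ = 0

prefixBody : Ty → Ty
prefixBody (all K T) = prefixBody T
prefixBody T = T

chainHead : Ty → Ty
chainHead (T ⇒ U) = chainHead U
chainHead T = T

-- No existential variables: no free variables, and every ∀-bound
-- variable of the prefix occurs in the head A.
NoExist : Ty → Set
NoExist T = (names T ≡ []) ×
            (∀ i → i < prefixLen T → Occ i (chainHead (prefixBody T)))

GoodType : Sig → Ty → Set
GoodType sg T = WKType sg T × Form T × NoExist T

-- Evidence.  Evidence variables/constants are named; λx.e binds a type
-- variable (de Bruijn index 0 in the types inside e).

data Ev : Set where
  var  : ℕ → Ev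
  cst  : ℕ → Ev
  lamE : ℕ → Ev → Ev
  appE : Ev → Ev → Ev
  mu   : ℕ → Ev → Ev
  tapp : Ev → Ty → Ev
  tlam : Ev → Ev

data Hd : Set where
  evar : ℕ → Hd
  econ : ℕ → Hd

hdEv : Hd → Ev
hdEv (evar α) = var α
hdEv (econ κ) = cst κ

appsE : Ev → List Ev → Ev
appsE e [] = e
appsE e (e' ∷ es) = appsE (appE e e') es

substE : ℕ → Ty → Ev → Ev
substE k U (var α) = var α
substE k U (cst κ) = cst κ
substE k U (lamE α e) = lamE α (substE k U e)
substE k U (appE e e') = appE (substE k U e) (substE k U e')
substE k U (mu α e) = mu α (substE k U e)
substE k U (tapp e T) = tapp (substE k U e) (substAt k U T)
substE k U (tlam e) = tlam (substE (suc k) (shift 0 U) e)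

namesE : Ev → List ℕ
namesE (var α) = []
namesE (cst κ) = []
namesE (lamE α e) = namesE e
namesE (appE e e') = namesE e ++ namesE e'
namesE (mu α e) = namesE e
namesE (tapp e T) = namesE e ++ names T
namesE (tlam e) = namesE e

erase : Ev → Ev
erase (var α) = var α
erase (cst κ) = cst κ
erase (lamE α e) = lamE α (erase e)
erase (appE e e') = appE (erase e) (erase e')
erase (mu α e) = mu α (erase e)
erase (tapp e T) = erase e
erase (tlam e) = erase e

data Curry : Ev → Set where
  cu-var : ∀ {α} → Curry (var α)
  cu-cst : ∀ {κ} → Curry (cst κ)
  cu-lam : ∀ {α e} → Curry e → Curry (lamE α e)
  cu-app : ∀ {e e'} → Curry e → Curry e' → Curry (appE e e')
  cu-mu  : ∀ {α e} → Curry e → Curry (mu α e)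

-- Environments: lists of declarations, most recent first; lookup
-- finds the most recent declaration of a head.

Ctx : Set
Ctx = List (Hd × Ty)

data _∋_∶_ : Ctx → Hd → Ty → Set where
  here  : ∀ {Γ h T} → ((h , T) ∷ Γ) ∋ h ∶ T
  there : ∀ {Γ h h' T T'} → h ≢ h' → Γ ∋ h ∶ T → ((h' , T') ∷ Γ) ∋ h ∶ T

namesCtx : Ctx → List ℕ
namesCtx Γ = concatMap (λ p → names (proj₂ p)) Γ

extend : Ctx → List (ℕ × Ty) → Ctx
extend Γ [] = Γ
extend Γ ((α , T) ∷ ds) = extend ((evar α , T) ∷ Γ) ds

data _∣_⊢_∶_ (sg : Sig) : Ctx → Ev → Ty → Set where
  t-hd   : ∀ {Γ h T} → Γ ∋ h ∶ T → sg ∣ Γ ⊢ hdEv h ∶ T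
  t-app  : ∀ {Γ e₁ e₂ T T'} → sg ∣ Γ ⊢ e₁ ∶ T' → sg ∣ Γ ⊢ e₂ ∶ (T' ⇒ T) →
           sg ∣ Γ ⊢ appE e₂ e₁ ∶ T
  t-lam  : ∀ {Γ α e T T'} → sg ∣ ((evar α , T') ∷ Γ) ⊢ e ∶ T →
           sg ∣ Γ ⊢ lamE α e ∶ (T' ⇒ T)
  t-mu   : ∀ {Γ α e T} → sg ∣ ((evar α , T) ∷ Γ) ⊢ e ∶ T →
           sg ∣ Γ ⊢ mu α e ∶ T
  t-inst : ∀ {Γ e K T T'} → sg ∣ Γ ⊢ e ∶ all K T → sg ︔ [] ⊢ T' ∶ tk K →
           sg ∣ Γ ⊢ tapp e T' ∶ subst0 T' T
  -- λx.e : ∀x:K.T from e : T with x ∉ FV(Γ) (x also fresh for e, T,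
  -- the locally nameless rendering of the named rule)
  t-abs  : ∀ {Γ e K T} (x : ℕ) → x ∉ namesCtx Γ → x ∉ namesE e → x ∉ names T →
           sg ∣ Γ ⊢ substE 0 (fv x K) e ∶ subst0 (fv x K) T →
           sg ∣ Γ ⊢ tlam e ∶ all K T
  t-conv : ∀ {Γ e T T'} → sg ∣ Γ ⊢ e ∶ T → T ↔o* T' → WK sg T' →
           sg ∣ Γ ⊢ e ∶ T'

-- V: the (flexible) matching
-- variables; U: names already in use (fresh names must avoid them).
-- Problems are taken up to ↔o* (terms are considered modulo β).

spine : Ty → List Ty → Ty
spine h [] = h
spine h (A ∷ As) = spine (app h A) As

Problems : Set
Problems = List (Ty × Ty)

namesP : Problems → List ℕ
namesP E = concatMap (λ p → names (proj₁ p) ++ names (proj₂ p)) E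

substP : ℕ → Ty → Problems → Problems
substP y t E = map (λ p → substFv y t (proj₁ p) , substFv y t (proj₂ p)) E

data Rigid (V : List ℕ) : Ty → Set where
  r-con : ∀ {F} → Rigid V (con F)
  r-fv  : ∀ {z K} → z ∉ V → Rigid V (fv z K)

lams : ℕ → Ty → Ty
lams zero T = T
lams (suc n) T = lam (lams n T)

-- x₁ … xₙ under n binders: bv (n-1), …, bv 0
bvs : ℕ → List Ty
bvs zero = []
bvs (suc n) = bv n ∷ bvs n

-- λx₁…λxₙ. xᵢ
projTerm : (n : ℕ) → Fin n → Ty
projTerm n i = lams n (bv (n ∸ suc (toℕ i)))

-- λx₁…λxₙ. a (y₁ x̲) ⋯ (yₘ x̲)
imiTerm : (n : ℕ) → Ty → List (ℕ × Kind) → Ty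
imiTerm n a ys = lams n (spine a (map (λ p → spine (fv (proj₁ p) (proj₂ p)) (bvs n)) ys))

-- accumulated substitution, applied left to right
Subst : Set
Subst = List (ℕ × Ty)

applyS : Subst → Ty → Ty
applyS [] T = T
applyS ((y , t) ∷ σ) T = applyS σ (substFv y t T)

data Match (sg : Sig) : List ℕ → List ℕ → Problems → Subst → Set where
  m-done : ∀ {V U} → Match sg V U [] []
  m-dec  : ∀ {V U E₁ E₂ L R σ} (a : Ty) (As Bs : List Ty) →
           Rigid V a → length As ≡ length Bs →
           L ↔o* spine a As → R ↔o* spine a Bs →
           Match sg V U (E₁ ++ zip As Bs ++ E₂) σ →
           Match sg V U (E₁ ++ (L , R) ∷ E₂) σ
  m-proj : ∀ {V U E₁ E₂ L R σ} (y : ℕ) (K : Kind) (As : List Ty) (a : Ty)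
           (Bs : List Ty) (i : Fin (length As)) →
           y ∈ V → Rigid V a →
           L ↔o* spine (fv y K) As → R ↔o* spine a Bs →
           sg ︔ [] ⊢ projTerm (length As) i ∶ tk K →
           Match sg V U (substP y (projTerm (length As) i) (E₁ ++ (L , R) ∷ E₂)) σ →
           Match sg V U (E₁ ++ (L , R) ∷ E₂) ((y , projTerm (length As) i) ∷ σ)
  m-imi  : ∀ {V U E₁ E₂ L R σ} (y : ℕ) (K : Kind) (As : List Ty) (a : Ty)
           (Bs : List Ty) (ys : List (ℕ × Kind)) →
           y ∈ V → Rigid V a →
           L ↔o* spine (fv y K) As → R ↔o* spine a Bs →
           length ys ≡ length Bs →
           Unique (map proj₁ ys) →
           All (λ p → proj₁ p ∉ U × proj₁ p ∉ V × proj₁ p ∉ namesP (E₁ ++ (L , R) ∷ E₂)) ys →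
           sg ︔ [] ⊢ imiTerm (length As) a ys ∶ tk K →
           Match sg (map proj₁ ys ++ V) (map proj₁ ys ++ U)
                 (substP y (imiTerm (length As) a ys) (E₁ ++ (L , R) ∷ E₂)) σ →
           Match sg V U (E₁ ++ (L , R) ∷ E₂) ((y , imiTerm (length As) a ys) ∷ σ)

Triple : Set
Triple = Ctx × Ev × Ty

namesΦ : List Triple → List ℕ
namesΦ Φ = concatMap (λ t → namesCtx (proj₁ t) ++ namesE (proj₁ (proj₂ t)) ++ names (proj₂ (proj₂ t))) Φ

instAlls : List ℕ → Ty → Ty
instAlls [] T = T
instAlls (x ∷ xs) (all K T) = instAlls xs (subst0 (fv x K) T)
instAlls (x ∷ xs) T = T

Fresh : List ℕ → List Triple → Set
Fresh xs Φ = Unique xs × All (λ x → x ∉ namesΦ Φ) xs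

lamsE : List (ℕ × Ty) → Ev → Ev
lamsE [] e = e
lamsE ((α , _) ∷ ds) e = lamE α (lamsE ds e)

data Step (sg : Sig) : List Triple → List Triple → Set where
  -- (1)
  r-hd  : ∀ {Φ₁ Φ₂ Γ A} (h : Hd) (es : List Ev) (S : Ty) (Ks : List Kind)
          (body : Ty) (xs : List ℕ) (Ts : List Ty) (B : Ty) (σ : Subst) →
          Atom A →
          Γ ∋ h ∶ S → S ≡ alls Ks body → length xs ≡ length Ks →
          Fresh xs (Φ₁ ++ (Γ , appsE (hdEv h) es , A) ∷ Φ₂) →
          instAlls xs S ≡ arrows Ts B → length Ts ≡ length es →
          Match sg xs (xs ++ namesΦ (Φ₁ ++ (Γ , appsE (hdEv h) es , A) ∷ Φ₂))
                ((B , A) ∷ []) σ →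
          Step sg (Φ₁ ++ (Γ , appsE (hdEv h) es , A) ∷ Φ₂)
               (Φ₁ ++ map (λ p → (Γ , proj₁ p , applyS σ (proj₂ p))) (zip es Ts) ++ Φ₂)
  -- (2)
  r-lam : ∀ {Φ₁ Φ₂ Γ e A} (ds : List (ℕ × Ty)) →
          1 ≤ length ds → Atom A →
          Step sg (Φ₁ ++ (Γ , lamsE ds e , arrows (map proj₂ ds) A) ∷ Φ₂)
               (Φ₁ ++ (extend Γ ds , e , A) ∷ Φ₂)
  -- (3)
  r-all : ∀ {Φ₁ Φ₂ Γ e T} (Ks : List Kind) (xs : List ℕ) →
          1 ≤ length Ks → length xs ≡ length Ks →
          Fresh xs (Φ₁ ++ (Γ , e , alls Ks T) ∷ Φ₂) →
          Step sg (Φ₁ ++ (Γ , e , alls Ks T) ∷ Φ₂)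
               (Φ₁ ++ (Γ , e , instAlls xs (alls Ks T)) ∷ Φ₂)
  -- (4)
  r-mu  : ∀ {Φ₁ Φ₂ Γ α e T} →
          Step sg (Φ₁ ++ (Γ , mu α e , T) ∷ Φ₂)
               (Φ₁ ++ (((evar α , T) ∷ Γ) , e , T) ∷ Φ₂)

_⊢_⟶*_ : Sig → List Triple → List Triple → Set
sg ⊢ Φ ⟶* Φ' = Star (Step sg) Φ Φ'

module Submission where

-- The run is read backwards.  Each rule rewrites one triple into
-- premises; we show it keeps a forward invariant (Curry-style evidence,
-- well-kinded environment and type) and that typed evidences for the
-- premises yield one for the rewritten triple.  Rules (2) and (4) are
-- the λ and μ typing rules.  Rule (3) needs ∀-introduction for fresh
-- eigenvariables, proved by renaming an eigenvariable to a name fresh for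
-- a whole derivation.  Rule (1) needs soundness of second-order
-- matching: the answer σ unifies B and A up to conversion, fixes A and
-- the environment, and preserves kinding.  Kind preservation is the
-- delicate point; it is an invariant of matching runs (kind coherence
-- of flexible names) whose decomposition step relies on the
-- Church–Rosser property of β on types, proved by parallel reduction.

open import Defs
open import Data.Nat using (ℕ; zero; suc; pred; _<_; _≤_; _⊔_; z≤n; s≤s; _≟_; _<?_)
open import Data.Nat.Properties
open import Data.Empty using (⊥; ⊥-elim)
open import Data.Unit using (⊤; tt)
open import Data.Product using (∃; _×_; _,_; proj₁; proj₂)
import Data.Product as Product
open import Data.Sum using (_⊎_; inj₁; inj₂; [_,_]′)
import Data.Sum as Sum
open import Data.Maybe using (just)
open import Data.List using (List; []; _∷_; _++_; length; map; zip; foldr)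
open import Data.List.Relation.Unary.All using (All; []; _∷_)
import Data.List.Relation.Unary.All as All
import Data.List.Relation.Unary.All.Properties as AllP
open import Data.List.Relation.Unary.Any using (Any; here; there)
open import Data.List.Membership.Propositional using (_∈_; _∉_)
open import Data.List.Membership.Propositional.Properties using (∈-++⁺ˡ; ∈-++⁺ʳ; ∈-++⁻; ∈-map⁺; ∈-map⁻)
open import Data.List.Relation.Binary.Pointwise using (Pointwise; []; _∷_)
import Data.List.Relation.Binary.Pointwise as Pw
open import Data.List.Relation.Unary.Unique.Propositional using (Unique)
open import Data.List.Relation.Unary.AllPairs using ([]; _∷_)
open import Relation.Nullary using (Dec; yes; no)
open import Relation.Binary.PropositionalEquality using (_≡_; _≢_; refl; sym; trans; cong; cong₂; subst; subst₂)
open import Relation.Binary.Definitions using (tri<; tri≈; tri>)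
open import Relation.Binary.Construct.Closure.ReflexiveTransitive using (Star; ε; _◅_; _◅◅_; gmap)
open import Relation.Binary.Construct.Closure.Symmetric using (fwd; bwd)
open import Relation.Binary.Construct.Closure.Equivalence using (symmetric)
import Relation.Binary.Construct.Closure.Equivalence as EqClosure
open import Data.List.Properties using (map-id; map-∘)

shift-below : ∀ {c i} → i < c → shift c (bv i) ≡ bv i
shift-below {c} {i} p with i <? c
... | yes _ = refl
... | no q = ⊥-elim (q p)

shift-above : ∀ {c i} → c ≤ i → shift c (bv i) ≡ bv (suc i)
shift-above {c} {i} p with i <? c
... | yes q = ⊥-elim (<⇒≱ q p)
... | no _ = refl

subst-below : ∀ {k i U} → i < k → substAt k U (bv i) ≡ bv i
subst-below {k} {i} p with i <? k
... | yes _ = refl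
... | no q = ⊥-elim (q p)

subst-here : ∀ {k U} → substAt k U (bv k) ≡ U
subst-here {k} with k <? k
... | yes q = ⊥-elim (<-irrefl refl q)
... | no _ with k ≟ k
...   | yes _ = refl
...   | no q = ⊥-elim (q refl)

subst-above : ∀ {k i U} → k < i → substAt k U (bv i) ≡ bv (pred i)
subst-above {k} {i} p with i <? k
... | yes q = ⊥-elim (<-asym p q)
... | no _ with i ≟ k
...   | yes q = ⊥-elim (<-irrefl (sym q) p)
...   | no _ = refl

shift-shift : ∀ d c T → d ≤ c → shift (suc c) (shift d T) ≡ shift d (shift c T)
shift-shift d c (con x) p = refl
shift-shift d c (fv x x₁) p = refl
shift-shift d c (bv i) p with <-cmp i d
... | tri< a _ _ rewrite shift-below {d} a
    | shift-below {c} (<-≤-trans a p)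
    | shift-below {suc c} (m<n⇒m<1+n (<-≤-trans a p))
    | shift-below {d} a = refl
... | tri≈ _ refl _ with <-cmp i c
...   | tri< b _ _ rewrite shift-above {d} {d} ≤-refl
    | shift-below {suc c} {suc d} (s≤s b)
    | shift-below {c} b
    | shift-above {d} {d} ≤-refl = refl
...   | tri≈ _ refl _ rewrite shift-above {c} {c} ≤-refl
    | shift-above {suc c} {suc c} ≤-refl
    | shift-above {c} {suc c} (n≤1+n c) = refl
...   | tri> _ _ b = ⊥-elim (<⇒≱ b p)
shift-shift d c (bv i) p | tri> _ _ a with <-cmp i c
... | tri< b _ _ rewrite shift-above {d} {i} (<⇒≤ a)
    | shift-below {suc c} {suc i} (s≤s b)
    | shift-below {c} b
    | shift-above {d} {i} (<⇒≤ a) = refl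
... | tri≈ _ refl _ rewrite shift-above {d} {i} (<⇒≤ a)
    | shift-above {suc i} {suc i} ≤-refl
    | shift-above {i} {i} ≤-refl
    | shift-above {d} {suc i} (≤-trans (<⇒≤ a) (n≤1+n i)) = refl
... | tri> _ _ b rewrite shift-above {d} {i} (<⇒≤ a)
    | shift-above {suc c} {suc i} (s≤s (<⇒≤ b))
    | shift-above {c} {i} (<⇒≤ b)
    | shift-above {d} {suc i} (≤-trans (<⇒≤ a) (n≤1+n i)) = refl
shift-shift d c (lam T) p = cong lam (shift-shift (suc d) (suc c) T (s≤s p))
shift-shift d c (all K T) p = cong (all K) (shift-shift (suc d) (suc c) T (s≤s p))
shift-shift d c (app T U) p = cong₂ app (shift-shift d c T p) (shift-shift d c U p)
shift-shift d c (T ⇒ U) p = cong₂ _⇒_ (shift-shift d c T p) (shift-shift d c U p)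

subst-shift : ∀ k U T → substAt k U (shift k T) ≡ T
subst-shift k U (con x) = refl
subst-shift k U (fv x x₁) = refl
subst-shift k U (bv i) with <-cmp i k
... | tri< a _ _ rewrite shift-below {k} a | subst-below {k} {i} {U} a = refl
... | tri≈ _ refl _ rewrite shift-above {i} {i} ≤-refl | subst-above {i} {suc i} {U} ≤-refl = refl
... | tri> _ _ a rewrite shift-above {k} {i} (<⇒≤ a) | subst-above {k} {suc i} {U} (m<n⇒m<1+n a) = refl
subst-shift k U (lam T) = cong lam (subst-shift (suc k) (shift 0 U) T)
subst-shift k U (all K T) = cong (all K) (subst-shift (suc k) (shift 0 U) T)
subst-shift k U (app T T₁) = cong₂ app (subst-shift k U T) (subst-shift k U T₁)
subst-shift k U (T ⇒ T₁) = cong₂ _⇒_ (subst-shift k U T) (subst-shift k U T₁)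

shift-subst-outer : ∀ c k U T → c ≤ k → shift c (substAt k U T) ≡ substAt (suc k) (shift c U) (shift c T)
shift-subst-outer c k U (con x) p = refl
shift-subst-outer c k U (fv x x₁) p = refl
shift-subst-outer c k U (bv i) p with <-cmp i c
... | tri< a _ _ rewrite subst-below {k} {i} {U} (<-≤-trans a p)
    | shift-below {c} a
    | subst-below {suc k} {i} {shift c U} (m<n⇒m<1+n (<-≤-trans a p)) = refl
... | tri≈ _ refl _ with <-cmp i k
...   | tri< b _ _ rewrite subst-below {k} {i} {U} b
    | shift-above {i} {i} ≤-refl
    | subst-below {suc k} {suc i} {shift i U} (s≤s b) = refl
...   | tri≈ _ refl _ rewrite subst-here {i} {U} | shift-above {i} {i} ≤-refl | subst-here {suc i} {shift i U} = refl
...   | tri> _ _ b = ⊥-elim (<⇒≱ b p)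
shift-subst-outer c k U (bv i) p | tri> _ _ a with <-cmp i k
... | tri< b _ _ rewrite subst-below {k} {i} {U} b
    | shift-above {c} {i} (<⇒≤ a)
    | subst-below {suc k} {suc i} {shift c U} (s≤s b) = refl
... | tri≈ _ refl _ rewrite subst-here {i} {U} | shift-above {c} {i} (<⇒≤ a) | subst-here {suc i} {shift c U} = refl
shift-subst-outer c k U (bv (suc i)) p | tri> _ _ a | tri> _ _ b rewrite subst-above {k} {suc i} {U} b
    | shift-above {c} {i} (≤-trans p (≤-pred b))
    | shift-above {c} {suc i} (<⇒≤ a)
    | subst-above {suc k} {suc (suc i)} {shift c U} (s≤s b) = refl
shift-subst-outer c k U (lam T) p rewrite shift-subst-outer (suc c) (suc k) (shift 0 U) T (s≤s p)
    | shift-shift 0 c U z≤n = refl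
shift-subst-outer c k U (all K T) p rewrite shift-subst-outer (suc c) (suc k) (shift 0 U) T (s≤s p)
    | shift-shift 0 c U z≤n = refl
shift-subst-outer c k U (app T T₁) p = cong₂ app (shift-subst-outer c k U T p) (shift-subst-outer c k U T₁ p)
shift-subst-outer c k U (T ⇒ T₁) p = cong₂ _⇒_ (shift-subst-outer c k U T p) (shift-subst-outer c k U T₁ p)

shift-subst-inner : ∀ c k U T → k ≤ c → shift c (substAt k U T) ≡ substAt k (shift c U) (shift (suc c) T)
shift-subst-inner c k U (con x) p = refl
shift-subst-inner c k U (fv x x₁) p = refl
shift-subst-inner c k U (bv i) p with <-cmp i k
... | tri< a _ _ rewrite subst-below {k} {i} {U} a
    | shift-below {c} (<-≤-trans a p)
    | shift-below {suc c} (m<n⇒m<1+n (<-≤-trans a p))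
    | subst-below {k} {i} {shift c U} a = refl
... | tri≈ _ refl _ rewrite subst-here {i} {U} | shift-below {suc c} {i} (s≤s p) | subst-here {i} {shift c U} = refl
shift-subst-inner c k U (bv (suc j)) p | tri> _ _ a with <-cmp j c
... | tri< b _ _ rewrite subst-above {k} {suc j} {U} a
    | shift-below {c} b
    | shift-below {suc c} {suc j} (s≤s b)
    | subst-above {k} {suc j} {shift c U} a = refl
... | tri≈ _ refl _ rewrite subst-above {k} {suc j} {U} a
    | shift-above {j} {j} ≤-refl
    | shift-above {suc j} {suc j} ≤-refl
    | subst-above {k} {suc (suc j)} {shift j U} (m<n⇒m<1+n a) = refl
... | tri> _ _ b rewrite subst-above {k} {suc j} {U} a
    | shift-above {c} {j} (<⇒≤ b)
    | shift-above {suc c} {suc j} (s≤s (<⇒≤ b))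
    | subst-above {k} {suc (suc j)} {shift c U} (m<n⇒m<1+n a) = refl
shift-subst-inner c k U (lam T) p rewrite shift-subst-inner (suc c) (suc k) (shift 0 U) T (s≤s p)
    | shift-shift 0 c U z≤n = refl
shift-subst-inner c k U (all K T) p rewrite shift-subst-inner (suc c) (suc k) (shift 0 U) T (s≤s p)
    | shift-shift 0 c U z≤n = refl
shift-subst-inner c k U (app T T₁) p = cong₂ app (shift-subst-inner c k U T p) (shift-subst-inner c k U T₁ p)
shift-subst-inner c k U (T ⇒ T₁) p = cong₂ _⇒_ (shift-subst-inner c k U T p) (shift-subst-inner c k U T₁ p)

substAt-substAt : ∀ j k U V T → j ≤ k → substAt k U (substAt j V T) ≡ substAt j (substAt k U V) (substAt (suc k) (shift j U) T)
substAt-substAt j k U V (con x) p = refl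
substAt-substAt j k U V (fv x x₁) p = refl
substAt-substAt j k U V (bv i) p with <-cmp i j
... | tri< a _ _ rewrite subst-below {j} {i} {V} a
    | subst-below {k} {i} {U} (<-≤-trans a p)
    | subst-below {suc k} {i} {shift j U} (m<n⇒m<1+n (<-≤-trans a p))
    | subst-below {j} {i} {substAt k U V} a = refl
... | tri≈ _ refl _ rewrite subst-here {i} {V}
    | subst-below {suc k} {i} {shift i U} (s≤s p)
    | subst-here {i} {substAt k U V} = refl
substAt-substAt j k U V (bv (suc i)) p | tri> _ _ a with <-cmp i k
... | tri< b _ _ rewrite subst-above {j} {suc i} {V} a
    | subst-below {k} {i} {U} b
    | subst-below {suc k} {suc i} {shift j U} (s≤s b)
    | subst-above {j} {suc i} {substAt k U V} a = refl
... | tri≈ _ refl _ rewrite subst-above {j} {suc i} {V} a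
    | subst-here {i} {U}
    | subst-here {suc i} {shift j U}
    | subst-shift j (substAt i U V) U = refl
... | tri> _ _ b rewrite subst-above {j} {suc i} {V} a
    | subst-above {k} {i} {U} b
    | subst-above {suc k} {suc i} {shift j U} (s≤s b)
    | subst-above {j} {i} {substAt k U V} (≤-<-trans p b) = refl
substAt-substAt j k U V (lam T) p rewrite substAt-substAt (suc j) (suc k) (shift 0 U) (shift 0 V) T (s≤s p)
    | shift-subst-outer 0 k U V z≤n
    | shift-shift 0 j U z≤n = refl
substAt-substAt j k U V (all K T) p rewrite substAt-substAt (suc j) (suc k) (shift 0 U) (shift 0 V) T (s≤s p)
    | shift-subst-outer 0 k U V z≤n
    | shift-shift 0 j U z≤n = refl
substAt-substAt j k U V (app T T₁) p = cong₂ app (substAt-substAt j k U V T p) (substAt-substAt j k U V T₁ p)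
substAt-substAt j k U V (T ⇒ T₁) p = cong₂ _⇒_ (substAt-substAt j k U V T p) (substAt-substAt j k U V T₁ p)

infix 4 _⇛_
data _⇛_ : Ty → Ty → Set where
  p-con : ∀ {F} → con F ⇛ con F
  p-fv  : ∀ {x K} → fv x K ⇛ fv x K
  p-bv  : ∀ {i} → bv i ⇛ bv i
  p-lam : ∀ {T T'} → T ⇛ T' → lam T ⇛ lam T'
  p-all : ∀ {K T T'} → T ⇛ T' → all K T ⇛ all K T'
  p-app : ∀ {T T' U U'} → T ⇛ T' → U ⇛ U' → app T U ⇛ app T' U'
  p-arr : ∀ {T T' U U'} → T ⇛ T' → U ⇛ U' → (T ⇒ U) ⇛ (T' ⇒ U')
  p-β   : ∀ {T T' U U'} → T ⇛ T' → U ⇛ U' → app (lam T) U ⇛ subst0 U' T'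

⇛-refl : ∀ {T} → T ⇛ T
⇛-refl {con x} = p-con
⇛-refl {fv x x₁} = p-fv
⇛-refl {bv x} = p-bv
⇛-refl {lam T} = p-lam ⇛-refl
⇛-refl {all x T} = p-all ⇛-refl
⇛-refl {app T T₁} = p-app ⇛-refl ⇛-refl
⇛-refl {T ⇒ T₁} = p-arr ⇛-refl ⇛-refl

⇛-shift : ∀ c {T T'} → T ⇛ T' → shift c T ⇛ shift c T'
⇛-shift c p-con = p-con
⇛-shift c p-fv = p-fv
⇛-shift c p-bv = ⇛-refl
⇛-shift c (p-lam p) = p-lam (⇛-shift (suc c) p)
⇛-shift c (p-all p) = p-all (⇛-shift (suc c) p)
⇛-shift c (p-app p q) = p-app (⇛-shift c p) (⇛-shift c q)
⇛-shift c (p-arr p q) = p-arr (⇛-shift c p) (⇛-shift c q)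
⇛-shift c (p-β {T} {T'} {U} {U'} p q) rewrite shift-subst-inner c 0 U' T' z≤n = p-β (⇛-shift (suc c) p) (⇛-shift c q)

⇛-subst-bv : ∀ k i {U U'} → U ⇛ U' → substAt k U (bv i) ⇛ substAt k U' (bv i)
⇛-subst-bv k i q with i <? k
... | yes _ = p-bv
... | no _ with i ≟ k
...   | yes _ = q
...   | no _ = p-bv

⇛-subst : ∀ k {T T' U U'} → T ⇛ T' → U ⇛ U' → substAt k U T ⇛ substAt k U' T'
⇛-subst k p-con q = p-con
⇛-subst k p-fv q = p-fv
⇛-subst k (p-bv {i}) q = ⇛-subst-bv k i q
⇛-subst k (p-lam p) q = p-lam (⇛-subst (suc k) p (⇛-shift 0 q))
⇛-subst k (p-all p) q = p-all (⇛-subst (suc k) p (⇛-shift 0 q))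
⇛-subst k (p-app p p₁) q = p-app (⇛-subst k p q) (⇛-subst k p₁ q)
⇛-subst k (p-arr p p₁) q = p-arr (⇛-subst k p q) (⇛-subst k p₁ q)
⇛-subst k (p-β {T' = T'} {U' = V'} p p₁) q =
  subst (_ ⇛_) (sym (substAt-substAt 0 k _ V' T' z≤n)) (p-β (⇛-subst (suc k) p (⇛-shift 0 q)) (⇛-subst k p₁ q))

develop : Ty → Ty
develop (con F) = con F
develop (fv x K) = fv x K
develop (bv i) = bv i
develop (lam T) = lam (develop T)
develop (all K T) = all K (develop T)
develop (app (lam T) U) = subst0 (develop U) (develop T)
develop (app T U) = app (develop T) (develop U)
develop (T ⇒ U) = develop T ⇒ develop U

-- Takahashi's triangle: every parallel reduct of T reduces to develop T.
⇛-develop : ∀ {T T'} → T ⇛ T' → T' ⇛ develop T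
⇛-develop p-con = p-con
⇛-develop p-fv = p-fv
⇛-develop p-bv = p-bv
⇛-develop (p-lam p) = p-lam (⇛-develop p)
⇛-develop (p-all p) = p-all (⇛-develop p)
⇛-develop (p-app {con _} p q) = p-app (⇛-develop p) (⇛-develop q)
⇛-develop (p-app {fv _ _} p q) = p-app (⇛-develop p) (⇛-develop q)
⇛-develop (p-app {bv _} p q) = p-app (⇛-develop p) (⇛-develop q)
⇛-develop (p-app {lam _} (p-lam p) q) = p-β (⇛-develop p) (⇛-develop q)
⇛-develop (p-app {all _ _} p q) = p-app (⇛-develop p) (⇛-develop q)
⇛-develop (p-app {app _ _} p q) = p-app (⇛-develop p) (⇛-develop q)
⇛-develop (p-app {_ ⇒ _} p q) = p-app (⇛-develop p) (⇛-develop q)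
⇛-develop (p-arr p q) = p-arr (⇛-develop p) (⇛-develop q)
⇛-develop (p-β p q) = ⇛-subst 0 (⇛-develop p) (⇛-develop q)

_⇛*_ : Ty → Ty → Set
_⇛*_ = Star _⇛_

-- Strip lemma and confluence of ⇛*, both from the triangle property.
⇛-strip : ∀ {T A B} → T ⇛ A → T ⇛* B → ∃ λ D → (A ⇛* D) × (B ⇛ D)
⇛-strip {A = A} p ε = A , ε , p
⇛-strip p (q ◅ qs) with ⇛-strip (⇛-develop q) qs
... | D , r , s = D , (⇛-develop p ◅ r) , s

⇛*-confluent : ∀ {T A B} → T ⇛* A → T ⇛* B → ∃ λ D → (A ⇛* D) × (B ⇛* D)
⇛*-confluent {B = B} ε qs = B , qs , ε
⇛*-confluent (p ◅ ps) qs with ⇛-strip p qs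
... | D , r , s with ⇛*-confluent ps r
...   | E , u , v = E , u , (s ◅ v)

→o⇒⇛ : ∀ {T T'} → T →o T' → T ⇛ T'
→o⇒⇛ β = p-β ⇛-refl ⇛-refl
→o⇒⇛ (c-lam p) = p-lam (→o⇒⇛ p)
→o⇒⇛ (c-all p) = p-all (→o⇒⇛ p)
→o⇒⇛ (c-appˡ p) = p-app (→o⇒⇛ p) ⇛-refl
→o⇒⇛ (c-appʳ p) = p-app ⇛-refl (→o⇒⇛ p)
→o⇒⇛ (c-arrˡ p) = p-arr (→o⇒⇛ p) ⇛-refl
→o⇒⇛ (c-arrʳ p) = p-arr ⇛-refl (→o⇒⇛ p)

↔o*-join : ∀ {A B} → A ↔o* B → ∃ λ C → (A ⇛* C) × (B ⇛* C)
↔o*-join {A} ε = A , ε , ε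
↔o*-join (fwd p ◅ ps) with ↔o*-join ps
... | C , u , v = C , (→o⇒⇛ p ◅ u) , v
↔o*-join (bwd p ◅ ps) with ↔o*-join ps
... | C , u , v with ⇛-strip (→o⇒⇛ p) u
...   | D , r , s = D , r , (v ◅◅ (s ◅ ε))

_→o*_ : Ty → Ty → Set
_→o*_ = Star _→o_

→o*-lam : ∀ {T T'} → T →o* T' → lam T →o* lam T'
→o*-lam = gmap lam c-lam
→o*-all : ∀ {K T T'} → T →o* T' → all K T →o* all K T'
→o*-all = gmap (all _) c-all
→o*-app : ∀ {T T' U U'} → T →o* T' → U →o* U' → app T U →o* app T' U'
→o*-app {T} {T'} {U} {U'} p q = gmap (λ z → app z U) c-appˡ p ◅◅ gmap (app T') c-appʳ q
→o*-arr : ∀ {T T' U U'} → T →o* T' → U →o* U' → (T ⇒ U) →o* (T' ⇒ U')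
→o*-arr {T} {T'} {U} {U'} p q = gmap (λ z → z ⇒ U) c-arrˡ p ◅◅ gmap (T' ⇒_) c-arrʳ q

⇛⇒→o* : ∀ {T T'} → T ⇛ T' → T →o* T'
⇛⇒→o* p-con = ε
⇛⇒→o* p-fv = ε
⇛⇒→o* p-bv = ε
⇛⇒→o* (p-lam p) = →o*-lam (⇛⇒→o* p)
⇛⇒→o* (p-all p) = →o*-all (⇛⇒→o* p)
⇛⇒→o* (p-app p q) = →o*-app (⇛⇒→o* p) (⇛⇒→o* q)
⇛⇒→o* (p-arr p q) = →o*-arr (⇛⇒→o* p) (⇛⇒→o* q)
⇛⇒→o* (p-β p q) = →o*-app (→o*-lam (⇛⇒→o* p)) (⇛⇒→o* q) ◅◅ (β ◅ ε)

→o*⇒↔o* : ∀ {T T'} → T →o* T' → T ↔o* T'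
→o*⇒↔o* = gmap (λ z → z) fwd

⇛*⇒↔o* : ∀ {T T'} → T ⇛* T' → T ↔o* T'
⇛*⇒↔o* ε = ε
⇛*⇒↔o* (p ◅ ps) = →o*⇒↔o* (⇛⇒→o* p) ◅◅ ⇛*⇒↔o* ps

data FvIn (x : ℕ) (K : Kind) : Ty → Set where
  here : FvIn x K (fv x K)
  i-lam : ∀ {T} → FvIn x K T → FvIn x K (lam T)
  i-all : ∀ {K' T} → FvIn x K T → FvIn x K (all K' T)
  i-appˡ : ∀ {T U} → FvIn x K T → FvIn x K (app T U)
  i-appʳ : ∀ {T U} → FvIn x K U → FvIn x K (app T U)
  i-arrˡ : ∀ {T U} → FvIn x K T → FvIn x K (T ⇒ U)
  i-arrʳ : ∀ {T U} → FvIn x K U → FvIn x K (T ⇒ U)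

fvin-shift : ∀ {x K} c T → FvIn x K (shift c T) → FvIn x K T
fvin-shift c (fv _ _) here = here
fvin-shift c (bv i) p with i <? c
fvin-shift c (bv i) () | yes _
fvin-shift c (bv i) () | no _
fvin-shift c (lam T) (i-lam p) = i-lam (fvin-shift (suc c) T p)
fvin-shift c (all K T) (i-all p) = i-all (fvin-shift (suc c) T p)
fvin-shift c (app T U) (i-appˡ p) = i-appˡ (fvin-shift c T p)
fvin-shift c (app T U) (i-appʳ p) = i-appʳ (fvin-shift c U p)
fvin-shift c (T ⇒ U) (i-arrˡ p) = i-arrˡ (fvin-shift c T p)
fvin-shift c (T ⇒ U) (i-arrʳ p) = i-arrʳ (fvin-shift c U p)

fvin-subst : ∀ {x K} k U T → FvIn x K (substAt k U T) → FvIn x K U ⊎ FvIn x K T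
fvin-subst k U (fv _ _) here = inj₂ here
fvin-subst k U (bv i) p with i <? k
fvin-subst k U (bv i) () | yes _
... | no _ with i ≟ k
...   | yes _ = inj₁ p
fvin-subst k U (bv i) () | no _ | no _
fvin-subst k U (lam T) (i-lam p) with fvin-subst (suc k) (shift 0 U) T p
... | inj₁ q = inj₁ (fvin-shift 0 U q)
... | inj₂ q = inj₂ (i-lam q)
fvin-subst k U (all K T) (i-all p) with fvin-subst (suc k) (shift 0 U) T p
... | inj₁ q = inj₁ (fvin-shift 0 U q)
... | inj₂ q = inj₂ (i-all q)
fvin-subst k U (app T T') (i-appˡ p) = Sum.map₂ i-appˡ (fvin-subst k U T p)
fvin-subst k U (app T T') (i-appʳ p) = Sum.map₂ i-appʳ (fvin-subst k U T' p)
fvin-subst k U (T ⇒ T') (i-arrˡ p) = Sum.map₂ i-arrˡ (fvin-subst k U T p)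
fvin-subst k U (T ⇒ T') (i-arrʳ p) = Sum.map₂ i-arrʳ (fvin-subst k U T' p)

fvin-⇛ : ∀ {x K T T'} → T ⇛ T' → FvIn x K T' → FvIn x K T
fvin-⇛ p-fv here = here
fvin-⇛ (p-lam p) (i-lam q) = i-lam (fvin-⇛ p q)
fvin-⇛ (p-all p) (i-all q) = i-all (fvin-⇛ p q)
fvin-⇛ (p-app p p₁) (i-appˡ q) = i-appˡ (fvin-⇛ p q)
fvin-⇛ (p-app p p₁) (i-appʳ q) = i-appʳ (fvin-⇛ p₁ q)
fvin-⇛ (p-arr p p₁) (i-arrˡ q) = i-arrˡ (fvin-⇛ p q)
fvin-⇛ (p-arr p p₁) (i-arrʳ q) = i-arrʳ (fvin-⇛ p₁ q)
fvin-⇛ (p-β {T' = T'} {U' = U'} p p₁) q with fvin-subst 0 U' T' q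
... | inj₁ r = i-appʳ (fvin-⇛ p₁ r)
... | inj₂ r = i-appˡ (i-lam (fvin-⇛ p r))

fvin-⇛* : ∀ {x K T T'} → T ⇛* T' → FvIn x K T' → FvIn x K T
fvin-⇛* ε q = q
fvin-⇛* (p ◅ ps) q = fvin-⇛ p (fvin-⇛* ps q)

data Neutral : Ty → Set where
  n-con : ∀ {F} → Neutral (con F)
  n-fv  : ∀ {x K} → Neutral (fv x K)
  n-app : ∀ {h A} → Neutral h → Neutral (app h A)

data RigidHead : Ty → Set where
  rh-con : ∀ {F} → RigidHead (con F)
  rh-fv  : ∀ {x K} → RigidHead (fv x K)

rigidHead-neutral : ∀ {a} → RigidHead a → Neutral a
rigidHead-neutral rh-con = n-con
rigidHead-neutral rh-fv = n-fv

rigidHead-⇛ : ∀ {a a'} → RigidHead a → a ⇛ a' → a' ≡ a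
rigidHead-⇛ rh-con p-con = refl
rigidHead-⇛ rh-fv p-fv = refl

neutral-spine-⇛ : ∀ {h As P} → Neutral h → spine h As ⇛ P →
  ∃ λ h' → ∃ λ As' → (P ≡ spine h' As') × (h ⇛ h') × Pointwise _⇛_ As As'
neutral-spine-⇛ {h} {[]} {P} n p = P , [] , refl , p , []
neutral-spine-⇛ {h} {A ∷ As} n p with neutral-spine-⇛ {app h A} {As} (n-app n) p
... | .(app _ _) , As' , eq , p-app q r , pw = _ , _ ∷ As' , eq , q , (r ∷ pw)

rigid-spine-⇛* : ∀ {a As P} → RigidHead a → spine a As ⇛* P →
  ∃ λ As' → (P ≡ spine a As') × Pointwise _⇛*_ As As'
rigid-spine-⇛* {a} {As} r ε = As , refl , Pw.refl ε
rigid-spine-⇛* {a} {As} r (p ◅ ps) with neutral-spine-⇛ (rigidHead-neutral r) p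
... | h' , As1 , refl , q , pw rewrite rigidHead-⇛ r q with rigid-spine-⇛* r ps
...   | As2 , eq , pw2 = As2 , eq , Pw.transitive _◅◅_ (Pw.map (λ z → z ◅ ε) pw) pw2

rigid-spine-conv : ∀ {L0 a As} → RigidHead a → L0 ↔o* spine a As →
  ∃ λ As' → Pointwise _↔o*_ As As' × (∀ {x K} → FvIn x K (spine a As') → FvIn x K L0)
rigid-spine-conv r e with ↔o*-join e
... | C , u , v with rigid-spine-⇛* r v
...   | As' , refl , pw = As' , Pw.map ⇛*⇒↔o* pw , λ q → fvin-⇛* u q

data LC : ℕ → Ty → Set where
  lc-con : ∀ {n F} → LC n (con F)
  lc-fv  : ∀ {n x K} → LC n (fv x K)
  lc-bv  : ∀ {n i} → i < n → LC n (bv i)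
  lc-lam : ∀ {n T} → LC (suc n) T → LC n (lam T)
  lc-all : ∀ {n K T} → LC (suc n) T → LC n (all K T)
  lc-app : ∀ {n T U} → LC n T → LC n U → LC n (app T U)
  lc-arr : ∀ {n T U} → LC n T → LC n U → LC n (T ⇒ U)

lc-sh : ∀ {n c T} → n ≤ c → LC n T → shift c T ≡ T
lc-sh p lc-con = refl
lc-sh p lc-fv = refl
lc-sh p (lc-bv x) = shift-below (<-≤-trans x p)
lc-sh p (lc-lam l) = cong lam (lc-sh (s≤s p) l)
lc-sh p (lc-all l) = cong (all _) (lc-sh (s≤s p) l)
lc-sh p (lc-app l l₁) = cong₂ app (lc-sh p l) (lc-sh p l₁)
lc-sh p (lc-arr l l₁) = cong₂ _⇒_ (lc-sh p l) (lc-sh p l₁)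

lc-sb : ∀ {n k U T} → n ≤ k → LC n T → substAt k U T ≡ T
lc-sb p lc-con = refl
lc-sb p lc-fv = refl
lc-sb p (lc-bv x) = subst-below (<-≤-trans x p)
lc-sb p (lc-lam l) = cong lam (lc-sb (s≤s p) l)
lc-sb p (lc-all l) = cong (all _) (lc-sb (s≤s p) l)
lc-sb p (lc-app l l₁) = cong₂ app (lc-sb p l) (lc-sb p l₁)
lc-sb p (lc-arr l l₁) = cong₂ _⇒_ (lc-sb p l) (lc-sb p l₁)

lookupK-bound : ∀ Ψ i {K} → lookupK Ψ i ≡ just K → i < length Ψ
lookupK-bound [] i ()
lookupK-bound (x ∷ Ψ) zero p = s≤s z≤n
lookupK-bound (x ∷ Ψ) (suc i) p = s≤s (lookupK-bound Ψ i p)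

kinded-lc : ∀ {sg Ψ T S} → sg ︔ Ψ ⊢ T ∶ S → LC (length Ψ) T
kinded-lc k-con = lc-con
kinded-lc k-fv = lc-fv
kinded-lc {Ψ = Ψ} (k-bv {i = i} x) = lc-bv (lookupK-bound Ψ i x)
kinded-lc (k-lam k x) = lc-lam (kinded-lc k)
kinded-lc (k-all k x) = lc-all (kinded-lc k)
kinded-lc (k-app k k₁) = lc-app (kinded-lc k) (kinded-lc k₁)
kinded-lc (k-arr k x k₁ x₁) = lc-arr (kinded-lc k) (kinded-lc k₁)

lookupK-++ : ∀ Ψ Ψ' i {K} → lookupK Ψ i ≡ just K → lookupK (Ψ ++ Ψ') i ≡ just K
lookupK-++ [] Ψ' i ()
lookupK-++ (x ∷ Ψ) Ψ' zero p = p
lookupK-++ (x ∷ Ψ) Ψ' (suc i) p = lookupK-++ Ψ Ψ' i p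

kinding-weaken : ∀ {sg Ψ T S} Ψ' → sg ︔ Ψ ⊢ T ∶ S → sg ︔ (Ψ ++ Ψ') ⊢ T ∶ S
kinding-weaken Ψ' k-con = k-con
kinding-weaken Ψ' k-fv = k-fv
kinding-weaken {Ψ = Ψ} Ψ' (k-bv {i = i} x) = k-bv (lookupK-++ Ψ Ψ' i x)
kinding-weaken Ψ' (k-lam k x) = k-lam (kinding-weaken Ψ' k) x
kinding-weaken Ψ' (k-all k x) = k-all (kinding-weaken Ψ' k) x
kinding-weaken Ψ' (k-app k k₁) = k-app (kinding-weaken Ψ' k) (kinding-weaken Ψ' k₁)
kinding-weaken Ψ' (k-arr k x k₁ x₁) = k-arr (kinding-weaken Ψ' k) x (kinding-weaken Ψ' k₁) x₁

NameSubst : Set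
NameSubst = ℕ → Kind → Ty

substNames : NameSubst → Ty → Ty
substNames f (con F) = con F
substNames f (fv x K) = f x K
substNames f (bv i) = bv i
substNames f (lam T) = lam (substNames f T)
substNames f (all K T) = all K (substNames f T)
substNames f (app T U) = app (substNames f T) (substNames f U)
substNames f (T ⇒ U) = substNames f T ⇒ substNames f U

ClosedSubst : NameSubst → Set
ClosedSubst f = ∀ x K → LC 0 (f x K)

substNames-shift : ∀ f → ClosedSubst f → ∀ c T → substNames f (shift c T) ≡ shift c (substNames f T)
substNames-shift f cl c (con x) = refl
substNames-shift f cl c (fv x K) = sym (lc-sh z≤n (cl x K))
substNames-shift f cl c (bv i) with i <? c
... | yes _ = refl
... | no _ = refl
substNames-shift f cl c (lam T) = cong lam (substNames-shift f cl (suc c) T)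
substNames-shift f cl c (all K T) = cong (all K) (substNames-shift f cl (suc c) T)
substNames-shift f cl c (app T U) = cong₂ app (substNames-shift f cl c T) (substNames-shift f cl c U)
substNames-shift f cl c (T ⇒ U) = cong₂ _⇒_ (substNames-shift f cl c T) (substNames-shift f cl c U)

substNames-subst : ∀ f → ClosedSubst f → ∀ k U T → substNames f (substAt k U T) ≡ substAt k (substNames f U) (substNames f T)
substNames-subst f cl k U (con x) = refl
substNames-subst f cl k U (fv x K) = sym (lc-sb z≤n (cl x K))
substNames-subst f cl k U (bv i) with i <? k
... | yes _ = refl
... | no _ with i ≟ k
...   | yes _ = refl
...   | no _ = refl
substNames-subst f cl k U (lam T) rewrite substNames-subst f cl (suc k) (shift 0 U) T | substNames-shift f cl 0 U = refl
substNames-subst f cl k U (all K T) rewrite substNames-subst f cl (suc k) (shift 0 U) T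
    | substNames-shift f cl 0 U = refl
substNames-subst f cl k U (app T T₁) = cong₂ app (substNames-subst f cl k U T) (substNames-subst f cl k U T₁)
substNames-subst f cl k U (T ⇒ T₁) = cong₂ _⇒_ (substNames-subst f cl k U T) (substNames-subst f cl k U T₁)

substNames-→o : ∀ f → ClosedSubst f → ∀ {T T'} → T →o T' → substNames f T →o substNames f T'
substNames-→o f cl (β {T} {U}) rewrite substNames-subst f cl 0 U T = β
substNames-→o f cl (c-lam p) = c-lam (substNames-→o f cl p)
substNames-→o f cl (c-all p) = c-all (substNames-→o f cl p)
substNames-→o f cl (c-appˡ p) = c-appˡ (substNames-→o f cl p)
substNames-→o f cl (c-appʳ p) = c-appʳ (substNames-→o f cl p)
substNames-→o f cl (c-arrˡ p) = c-arrˡ (substNames-→o f cl p)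
substNames-→o f cl (c-arrʳ p) = c-arrʳ (substNames-→o f cl p)

substNames-↔o* : ∀ f → ClosedSubst f → ∀ {T T'} → T ↔o* T' → substNames f T ↔o* substNames f T'
substNames-↔o* f cl ε = ε
substNames-↔o* f cl (fwd p ◅ ps) = fwd (substNames-→o f cl p) ◅ substNames-↔o* f cl ps
substNames-↔o* f cl (bwd p ◅ ps) = bwd (substNames-→o f cl p) ◅ substNames-↔o* f cl ps

substNames-occ : ∀ f {k T} → Occ k T → Occ k (substNames f T)
substNames-occ f here = here
substNames-occ f (lam q) = lam (substNames-occ f q)
substNames-occ f (all q) = all (substNames-occ f q)
substNames-occ f (appˡ q) = appˡ (substNames-occ f q)
substNames-occ f (appʳ q) = appʳ (substNames-occ f q)
substNames-occ f (arrˡ q) = arrˡ (substNames-occ f q)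
substNames-occ f (arrʳ q) = arrʳ (substNames-occ f q)

substNames-kinding : ∀ {sg} f {Ψ T S} → sg ︔ Ψ ⊢ T ∶ S →
  (∀ {x K} → FvIn x K T → sg ︔ [] ⊢ f x K ∶ tk K) → sg ︔ Ψ ⊢ substNames f T ∶ S
substNames-kinding f k-con h = k-con
substNames-kinding f {Ψ} k-fv h = kinding-weaken Ψ (h here)
substNames-kinding f (k-bv x) h = k-bv x
substNames-kinding f (k-lam k x) h = k-lam (substNames-kinding f k (λ q → h (i-lam q))) (substNames-occ f x)
substNames-kinding f (k-all k x) h = k-all (substNames-kinding f k (λ q → h (i-all q))) x
substNames-kinding f (k-app k k₁) h = k-app (substNames-kinding f k (λ q → h (i-appˡ q))) (substNames-kinding f k₁ (λ q → h (i-appʳ q)))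
substNames-kinding f (k-arr k x k₁ x₁) h = k-arr (substNames-kinding f k (λ q → h (i-arrˡ q))) x (substNames-kinding f k₁ (λ q → h (i-arrʳ q))) x₁

substNames-fvin : ∀ f {z K'} T → FvIn z K' (substNames f T) → ∃ λ x → ∃ λ K → FvIn x K T × FvIn z K' (f x K)
substNames-fvin f (fv x K) p = x , K , here , p
substNames-fvin f (lam T) (i-lam p) with substNames-fvin f T p
... | x , K , q , r = x , K , i-lam q , r
substNames-fvin f (all _ T) (i-all p) with substNames-fvin f T p
... | x , K , q , r = x , K , i-all q , r
substNames-fvin f (app T U) (i-appˡ p) with substNames-fvin f T p
... | x , K , q , r = x , K , i-appˡ q , r
substNames-fvin f (app T U) (i-appʳ p) with substNames-fvin f U p
... | x , K , q , r = x , K , i-appʳ q , r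
substNames-fvin f (T ⇒ U) (i-arrˡ p) with substNames-fvin f T p
... | x , K , q , r = x , K , i-arrˡ q , r
substNames-fvin f (T ⇒ U) (i-arrʳ p) with substNames-fvin f U p
... | x , K , q , r = x , K , i-arrʳ q , r

substNames-id : ∀ f T → (∀ {x K} → FvIn x K T → f x K ≡ fv x K) → substNames f T ≡ T
substNames-id f (con x) h = refl
substNames-id f (fv x K) h = h here
substNames-id f (bv x) h = refl
substNames-id f (lam T) h = cong lam (substNames-id f T (λ q → h (i-lam q)))
substNames-id f (all K T) h = cong (all K) (substNames-id f T (λ q → h (i-all q)))
substNames-id f (app T U) h = cong₂ app (substNames-id f T (λ q → h (i-appˡ q))) (substNames-id f U (λ q → h (i-appʳ q)))
substNames-id f (T ⇒ U) h = cong₂ _⇒_ (substNames-id f T (λ q → h (i-arrˡ q))) (substNames-id f U (λ q → h (i-arrʳ q)))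

-- substFv y t is the name substitution sending y (of any kind) to t.
single : ℕ → Ty → NameSubst
single y t z K with y ≟ z
... | yes _ = t
... | no _ = fv z K

substFv≡substNames : ∀ y t → LC 0 t → ∀ T → substFv y t T ≡ substNames (single y t) T
substFv≡substNames y t l (con x) = refl
substFv≡substNames y t l (fv z K) with y ≟ z
... | yes _ = refl
... | no _ = refl
substFv≡substNames y t l (bv x) = refl
substFv≡substNames y t l (lam T) rewrite lc-sh {c = 0} z≤n l = cong lam (substFv≡substNames y t l T)
substFv≡substNames y t l (all K T) rewrite lc-sh {c = 0} z≤n l = cong (all K) (substFv≡substNames y t l T)
substFv≡substNames y t l (app T U) = cong₂ app (substFv≡substNames y t l T) (substFv≡substNames y t l U)
substFv≡substNames y t l (T ⇒ U) = cong₂ _⇒_ (substFv≡substNames y t l T) (substFv≡substNames y t l U)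

single-closed : ∀ y t → LC 0 t → ClosedSubst (single y t)
single-closed y t l z K with y ≟ z
... | yes _ = l
... | no _ = lc-fv

↔-app : ∀ {T T' U U'} → T ↔o* T' → U ↔o* U' → app T U ↔o* app T' U'
↔-app {T} {T'} {U} {U'} p q = EqClosure.gmap (λ z → app z U) c-appˡ p ◅◅ EqClosure.gmap (app T') c-appʳ q

↔-sym : ∀ {T T'} → T ↔o* T' → T' ↔o* T
↔-sym = symmetric _→o_

spine-↔ : ∀ {h h'} {As Bs} → h ↔o* h' → Pointwise _↔o*_ As Bs → spine h As ↔o* spine h' Bs
spine-↔ p [] = p
spine-↔ p (q ∷ qs) = spine-↔ (↔-app p q) qs

fvin-spine⁻ : ∀ {x K} h As → FvIn x K (spine h As) → FvIn x K h ⊎ Any (FvIn x K) As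
fvin-spine⁻ h [] p = inj₁ p
fvin-spine⁻ h (A ∷ As) p with fvin-spine⁻ (app h A) As p
... | inj₁ (i-appˡ q) = inj₁ q
... | inj₁ (i-appʳ q) = inj₂ (here q)
... | inj₂ q = inj₂ (there q)

fvin-spine-hd : ∀ {x K} h As → FvIn x K h → FvIn x K (spine h As)
fvin-spine-hd h [] p = p
fvin-spine-hd h (A ∷ As) p = fvin-spine-hd (app h A) As (i-appˡ p)

fvin-names : ∀ {x K} T → FvIn x K T → x ∈ names T
fvin-names (fv _ _) here = here refl
fvin-names (lam T) (i-lam p) = fvin-names T p
fvin-names (all _ T) (i-all p) = fvin-names T p
fvin-names (app T U) (i-appˡ p) = ∈-++⁺ˡ (fvin-names T p)
fvin-names (app T U) (i-appʳ p) = ∈-++⁺ʳ (names T) (fvin-names U p)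
fvin-names (T ⇒ U) (i-arrˡ p) = ∈-++⁺ˡ (fvin-names T p)
fvin-names (T ⇒ U) (i-arrʳ p) = ∈-++⁺ʳ (names T) (fvin-names U p)

names-fvin : ∀ {x} T → x ∈ names T → ∃ λ K → FvIn x K T
names-fvin (fv _ K) (here refl) = K , here
names-fvin (lam T) p = Product.map₂ i-lam (names-fvin T p)
names-fvin (all _ T) p = Product.map₂ i-all (names-fvin T p)
names-fvin (app T U) p with ∈-++⁻ (names T) p
... | inj₁ q = Product.map₂ i-appˡ (names-fvin T q)
... | inj₂ q = Product.map₂ i-appʳ (names-fvin U q)
names-fvin (T ⇒ U) p with ∈-++⁻ (names T) p
... | inj₁ q = Product.map₂ i-arrˡ (names-fvin T q)
... | inj₂ q = Product.map₂ i-arrʳ (names-fvin U q)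

substFv-fresh : ∀ y t T → y ∉ names T → substFv y t T ≡ T
substFv-fresh y t (con x) p = refl
substFv-fresh y t (fv z K) p with y ≟ z
... | yes refl = ⊥-elim (p (here refl))
... | no _ = refl
substFv-fresh y t (bv x) p = refl
substFv-fresh y t (lam T) p = cong lam (substFv-fresh y (shift 0 t) T p)
substFv-fresh y t (all K T) p = cong (all K) (substFv-fresh y (shift 0 t) T p)
substFv-fresh y t (app T U) p = cong₂ app (substFv-fresh y t T (λ q → p (∈-++⁺ˡ q))) (substFv-fresh y t U (λ q → p (∈-++⁺ʳ (names T) q)))
substFv-fresh y t (T ⇒ U) p = cong₂ _⇒_ (substFv-fresh y t T (λ q → p (∈-++⁺ˡ q))) (substFv-fresh y t U (λ q → p (∈-++⁺ʳ (names T) q)))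

ClosedS : Subst → Set
ClosedS σ = All (λ p → LC 0 (proj₂ p)) σ

applyS-↔ : ∀ σ → ClosedS σ → ∀ {T T'} → T ↔o* T' → applyS σ T ↔o* applyS σ T'
applyS-↔ [] l p = p
applyS-↔ ((y , t) ∷ σ) (l ∷ ls) {T} {T'} p rewrite substFv≡substNames y t l T | substFv≡substNames y t l T' =
  applyS-↔ σ ls (substNames-↔o* (single y t) (single-closed y t l) p)

applyS-spine : ∀ σ h As → applyS σ (spine h As) ≡ spine (applyS σ h) (map (applyS σ) As)
applyS-spine σ h [] = refl
applyS-spine σ h (A ∷ As) = trans (applyS-spine σ (app h A) As) (cong (λ z → spine z (map (applyS σ) As)) (ap σ h A))
  where
  ap : ∀ σ h A → applyS σ (app h A) ≡ app (applyS σ h) (applyS σ A)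
  ap [] h A = refl
  ap ((y , t) ∷ σ) h A = ap σ (substFv y t h) (substFv y t A)

zip-pw : ∀ {R : Ty → Ty → Set} {As Bs} → length As ≡ length Bs → All (λ p → R (proj₁ p) (proj₂ p)) (zip As Bs) → Pointwise R As Bs
zip-pw {As = []} {[]} e a = []
zip-pw {As = []} {B ∷ Bs} () a
zip-pw {As = A ∷ As} {[]} () a
zip-pw {As = A ∷ As} {B ∷ Bs} e (p ∷ ps) = p ∷ zip-pw (suc-injective e) ps

Solves : Subst → Ty × Ty → Set
Solves σ p = applyS σ (proj₁ p) ↔o* applyS σ (proj₂ p)

match-solves : ∀ {sg V U E σ} → Match sg V U E σ → ClosedS σ × All (Solves σ) E
match-solves m-done = [] , []
match-solves {σ = σ} (m-dec {E₁ = E₁} {E₂} {L} {R} a As Bs rg len pL pR m) with match-solves m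
... | lcs , sv with AllP.++⁻ E₁ sv
...   | s1 , s23 with AllP.++⁻ (zip As Bs) s23
...     | s2 , s3 = lcs , AllP.++⁺ s1 (solved ∷ s3)
  where
  pw : Pointwise _↔o*_ (map (applyS σ) As) (map (applyS σ) Bs)
  pw = Pw.map⁺ (applyS σ) (applyS σ) (zip-pw len s2)
  -- σL ↔ σ(a A̲) = σa σA̲ ↔ σa σB̲ = σ(a B̲) ↔ σR
  solved : applyS σ L ↔o* applyS σ R
  solved = applyS-↔ σ lcs pL ◅◅ subst (λ z → z ↔o* applyS σ (spine a Bs)) (sym (applyS-spine σ a As))
           (subst (λ z → spine (applyS σ a) (map (applyS σ) As) ↔o* z) (sym (applyS-spine σ a Bs)) (spine-↔ ε pw))
         ◅◅ applyS-↔ σ lcs (↔-sym pR)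
match-solves (m-proj {E₁ = E₁} {E₂} {L} {R} y K As a Bs i yV rg pL pR kd m) with match-solves m
... | lcs , sv = (kinded-lc kd ∷ lcs) , AllP.map⁻ sv
match-solves (m-imi {E₁ = E₁} {E₂} {L} {R} y K As a Bs ys yV rg pL pR len uq fr kd m) with match-solves m
... | lcs , sv = (kinded-lc kd ∷ lcs) , AllP.map⁻ sv

-- σ only substitutes matching variables, so it fixes types built from
-- names in use that are not matching variables.
match-fixes : ∀ {sg V U E σ} → Match sg V U E σ → ∀ T → (∀ {x} → x ∈ names T → x ∉ V × x ∈ U) → applyS σ T ≡ T
match-fixes m-done T h = refl
match-fixes (m-dec a As Bs x x₁ x₂ x₃ m) T h = match-fixes m T h
match-fixes (m-proj y K As a Bs i yV x₁ x₂ x₃ x₄ m) T h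
  rewrite substFv-fresh y (projTerm (length As) i) T (λ q → proj₁ (h q) yV) = match-fixes m T h
match-fixes {V = V} {U} (m-imi y K As a Bs ys yV x₁ x₂ x₃ x₄ x₅ fr x₇ m) T h
  rewrite substFv-fresh y (imiTerm (length As) a ys) T (λ q → proj₁ (h q) yV) = match-fixes m T h'
  where
  h' : ∀ {x} → x ∈ names T → x ∉ map proj₁ ys ++ V × x ∈ map proj₁ ys ++ U
  h' {x} q = (λ r → case (∈-++⁻ (map proj₁ ys) r)) , ∈-++⁺ʳ (map proj₁ ys) (proj₂ (h q))
    where
    case : x ∈ map proj₁ ys ⊎ x ∈ V → ⊥
    case (inj₂ r) = proj₁ (h q) r
    case (inj₁ r) with ∈-map⁻ proj₁ r
    ... | p , pin , refl = proj₁ (All.lookup fr pin) (proj₂ (h q))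

-- The kind-coherence invariant of a matching run.  κ assigns its kind to
-- each matching variable, V is the set of matching variables, U the
-- names in use.
module Coh (κ : ℕ → Kind) (V U : List ℕ) where
  GoodName : ℕ → Kind → Set
  GoodName x K = x ∈ U × (x ∈ V → K ≡ κ x)

  Good : Ty → Set
  Good T = ∀ {x K} → FvIn x K T → GoodName x K

  GoodProblem : Ty × Ty → Set
  GoodProblem p = ∃ λ L0 → ∃ λ R0 → (proj₁ p ↔o* L0) × (proj₂ p ↔o* R0) × Good L0 × Good R0

open Coh public

fvin-lams : ∀ {x K} n B → FvIn x K (lams n B) → FvIn x K B
fvin-lams zero B p = p
fvin-lams (suc n) B (i-lam p) = fvin-lams n B p

fvin-proj : ∀ {x K} n i → FvIn x K (projTerm n i) → ⊥
fvin-proj n i p with fvin-lams n _ p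
... | ()

fvin-bvs : ∀ {x K} n → Any (FvIn x K) (bvs n) → ⊥
fvin-bvs (suc n) (here ())
fvin-bvs (suc n) (there p) = fvin-bvs n p

fvin-imi : ∀ {x K} n a ys → FvIn x K (imiTerm n a ys) → FvIn x K a ⊎ (x , K) ∈ ys
fvin-imi {x} {K} n a ys p with fvin-spine⁻ a _ (fvin-lams n _ p)
... | inj₁ q = inj₁ q
... | inj₂ q = inj₂ (go ys q)
  where
  go : ∀ ys → Any (FvIn x K) (map (λ p → spine (fv (proj₁ p) (proj₂ p)) (bvs n)) ys) → (x , K) ∈ ys
  go ((y , Ky) ∷ ys) (here r) with fvin-spine⁻ (fv y Ky) (bvs n) r
  ... | inj₁ here = here refl
  ... | inj₂ s = ⊥-elim (fvin-bvs n s)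
  go (_ ∷ ys) (there r) = there (go ys r)

single-fvin : ∀ {z K} y t x K0 → FvIn z K (single y t x K0) → FvIn z K t ⊎ (z ≡ x × K ≡ K0)
single-fvin y t x K0 p with y ≟ x
... | yes _ = inj₁ p
single-fvin y t x K0 here | no _ = inj₂ (refl , refl)

good-substFv : ∀ {κ V U} y t → LC 0 t → ∀ X → Good κ V U X → Good κ V U t → Good κ V U (substFv y t X)
good-substFv y t l X gX gt p rewrite substFv≡substNames y t l X with substNames-fvin (single y t) X p
... | x , K0 , q , r with single-fvin y t x K0 r
... | inj₁ s = gt s
... | inj₂ (refl , refl) = gX q

substFv-kinding : ∀ {sg Ψ S Ky} y t → LC 0 t → sg ︔ [] ⊢ t ∶ tk Ky → ∀ X → (∀ {K'} → FvIn y K' X → K' ≡ Ky) →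
  sg ︔ Ψ ⊢ X ∶ S → sg ︔ Ψ ⊢ substFv y t X ∶ S
substFv-kinding {sg} {Ky = Ky} y t l kt X h kX rewrite substFv≡substNames y t l X = substNames-kinding (single y t) kX h'
  where
  h' : ∀ {x K} → FvIn x K X → sg ︔ [] ⊢ single y t x K ∶ tk K
  h' {x} {K} q with y ≟ x
  ... | yes refl rewrite h q = kt
  ... | no _ = k-fv

rigid-rigidHead : ∀ {V a} → Rigid V a → RigidHead a
rigid-rigidHead r-con = rh-con
rigid-rigidHead (r-fv _) = rh-fv

good-args : ∀ {κ V U} h As → (∀ {x K} → FvIn x K (spine h As) → GoodName κ V U x K) → All (Good κ V U) As
good-args h [] g = []
good-args h (A ∷ As) g = (λ p → g (fvin-spine-hd (app h A) As (i-appʳ p))) ∷ good-args (app h A) As g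

rep-flex-kind : ∀ {κ V U L R y K As} → GoodProblem κ V U (L , R) → L ↔o* spine (fv y K) As → y ∈ V → K ≡ κ y
rep-flex-kind {As = As} (L0 , R0 , pL , pR , gL , gR) q yV with rigid-spine-conv {As = As} rh-fv (↔-sym pL ◅◅ q)
... | As' , pw , inc = proj₂ (gL (inc (fvin-spine-hd _ As' here))) yV

rep-rigid-head : ∀ {κ V U L R z K Bs} → GoodProblem κ V U (L , R) → R ↔o* spine (fv z K) Bs → z ∈ U
rep-rigid-head {K = K} {Bs} (L0 , R0 , pL , pR , gL , gR) q with rigid-spine-conv {a = fv _ K} {As = Bs} rh-fv (↔-sym pR ◅◅ q)
... | As' , pw , inc = proj₁ (gR (inc (fvin-spine-hd _ As' here)))

-- Decomposition of a good problem yields good problems, by confluence.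
zip-rep : ∀ {κ V U As As' Bs Bs'} → Pointwise _↔o*_ As As' → Pointwise _↔o*_ Bs Bs' →
  All (Good κ V U) As' → All (Good κ V U) Bs' → All (GoodProblem κ V U) (zip As Bs)
zip-rep [] _ _ _ = []
zip-rep (_ ∷ _) [] _ _ = []
zip-rep (p ∷ ps) (q ∷ qs) (g ∷ gs) (h ∷ hs) = (_ , _ , p , q , g , h) ∷ zip-rep ps qs gs hs

rep-decompose : ∀ {κ V U L R a As Bs} → GoodProblem κ V U (L , R) → Rigid V a → L ↔o* spine a As → R ↔o* spine a Bs →
  All (GoodProblem κ V U) (zip As Bs)
rep-decompose {a = a} (L0 , R0 , pL , pR , gL , gR) rg qL qR with rigid-spine-conv (rigid-rigidHead rg) (↔-sym pL ◅◅ qL) | rigid-spine-conv (rigid-rigidHead rg) (↔-sym pR ◅◅ qR)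
... | As' , pwA , incA | Bs' , pwB , incB =
  zip-rep pwA pwB (good-args a As' (λ p → gL (incA p))) (good-args a Bs' (λ p → gR (incB p)))

rep-substFv : ∀ {κ V U} y t → LC 0 t → Good κ V U t → ∀ {p} → GoodProblem κ V U p →
  GoodProblem κ V U (substFv y t (proj₁ p) , substFv y t (proj₂ p))
rep-substFv y t l gt {L , R} (L0 , R0 , pL , pR , gL , gR) =
  substFv y t L0 , substFv y t R0 ,
  subst₂ _↔o*_ (sym (substFv≡substNames y t l L)) (sym (substFv≡substNames y t l L0)) (substNames-↔o* _ (single-closed y t l) pL) ,
  subst₂ _↔o*_ (sym (substFv≡substNames y t l R)) (sym (substFv≡substNames y t l R0)) (substNames-↔o* _ (single-closed y t l) pR) ,
  good-substFv y t l L0 gL gt , good-substFv y t l R0 gR gt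

extendKinds : List (ℕ × Kind) → (ℕ → Kind) → ℕ → Kind
extendKinds [] κ x = κ x
extendKinds ((y , K) ∷ ys) κ x with y ≟ x
... | yes _ = K
... | no _ = extendKinds ys κ x

extendKinds-∉ : ∀ ys κ x → x ∉ map proj₁ ys → extendKinds ys κ x ≡ κ x
extendKinds-∉ [] κ x p = refl
extendKinds-∉ ((y , K) ∷ ys) κ x p with y ≟ x
... | yes refl = ⊥-elim (p (here refl))
... | no _ = extendKinds-∉ ys κ x (λ q → p (there q))

extendKinds-∈ : ∀ ys κ {x K} → Unique (map proj₁ ys) → (x , K) ∈ ys → extendKinds ys κ x ≡ K
extendKinds-∈ ((y , K) ∷ ys) κ {x} u (here refl) with y ≟ x
... | yes _ = refl
... | no q = ⊥-elim (q refl)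
extendKinds-∈ ((y , K) ∷ ys) κ {x} (u ∷ us) (there p) with y ≟ x
... | yes refl = ⊥-elim (All.lookup u (∈-map⁺ proj₁ p) refl)
... | no _ = extendKinds-∈ ys κ us p

good-extend : ∀ {κ V U} ys → All (λ p → proj₁ p ∉ U) ys → ∀ {X} → Good κ V U X →
  Good (extendKinds ys κ) (map proj₁ ys ++ V) (map proj₁ ys ++ U) X
good-extend {κ} {V} {U} ys fr g {x} {K} p with g p
... | xU , xV = ∈-++⁺ʳ (map proj₁ ys) xU , h
  where
  notin : x ∉ map proj₁ ys
  notin q with ∈-map⁻ proj₁ q
  ... | p , pin , refl = All.lookup fr pin xU
  h : x ∈ map proj₁ ys ++ V → K ≡ extendKinds ys κ x
  h q with ∈-++⁻ (map proj₁ ys) q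
  ... | inj₁ r = ⊥-elim (notin r)
  ... | inj₂ r rewrite extendKinds-∉ ys κ x notin = xV r

rep-extend : ∀ {κ V U} ys → All (λ p → proj₁ p ∉ U) ys → ∀ {p} → GoodProblem κ V U p →
  GoodProblem (extendKinds ys κ) (map proj₁ ys ++ V) (map proj₁ ys ++ U) p
rep-extend ys fr (L0 , R0 , pL , pR , gL , gR) = L0 , R0 , pL , pR , good-extend ys fr gL , good-extend ys fr gR

rep-lookup : ∀ {κ V U} E₁ {E₂ p} → All (GoodProblem κ V U) (E₁ ++ p ∷ E₂) → GoodProblem κ V U p
rep-lookup E₁ reps with AllP.++⁻ E₁ reps
... | _ , (r ∷ _) = r

-- The names of an imitation term are good for the extended invariant:
-- its head a is rigid, hence an old non-flexible name in use, and the
-- fresh y̲ carry the kinds recorded for them.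
imitation-good : ∀ {κ V U a} n ys → Unique (map proj₁ ys) → All (λ p → proj₁ p ∉ U) ys → Rigid V a →
  (∀ {z K} → a ≡ fv z K → z ∈ U) → Good (extendKinds ys κ) (map proj₁ ys ++ V) (map proj₁ ys ++ U) (imiTerm n a ys)
imitation-good {κ} {V} {U} {a} n ys uq frU rg aU {z} {Kz} q with fvin-imi n a ys q
... | inj₂ zin = ∈-++⁺ˡ (∈-map⁺ proj₁ zin) , λ _ → sym (extendKinds-∈ ys κ uq zin)
... | inj₁ fa = rigid-name rg fa aU
  where
  fresh-not-used : z ∈ U → z ∉ map proj₁ ys
  fresh-not-used zU q with ∈-map⁻ proj₁ q
  ... | p , pin , refl = All.lookup frU pin zU
  rigid-name : ∀ {a'} → Rigid V a' → FvIn z Kz a' → (∀ {w K} → a' ≡ fv w K → w ∈ U) →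
    GoodName (extendKinds ys κ) (map proj₁ ys ++ V) (map proj₁ ys ++ U) z Kz
  rigid-name (r-fv zV) here aU' = ∈-++⁺ʳ (map proj₁ ys) (aU' refl) ,
    λ w → ⊥-elim ([ fresh-not-used (aU' refl) , zV ]′ (∈-++⁻ (map proj₁ ys) w))

-- Each projection or imitation binding is a closed type of the
-- kind of the variable it replaces, and the invariant is kept along the
-- run.
match-kinding : ∀ {sg V U E σ} → Match sg V U E σ → ∀ κ → All (GoodProblem κ V U) E →
  ∀ {Ψ S} T → Good κ V U T → sg ︔ Ψ ⊢ T ∶ S → sg ︔ Ψ ⊢ applyS σ T ∶ S
match-kinding m-done κ reps T gT kT = kT
match-kinding (m-dec {E₁ = E₁} {E₂} a As Bs rg len pL pR m) κ reps T gT kT with AllP.++⁻ E₁ reps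
... | r1 , (r ∷ r2) = match-kinding m κ (AllP.++⁺ r1 (AllP.++⁺ (rep-decompose r rg pL pR) r2)) T gT kT
match-kinding {V = V} {U} (m-proj {E₁ = E₁} {E₂} {L} {R} y K As a Bs i yV rg pL pR kd m) κ reps T gT kT =
  match-kinding m κ reps' (substFv y t T) (good-substFv y t lt T gT gt) (substFv-kinding y t lt kd T h kT)
  where
  t : Ty
  t = projTerm (length As) i
  lt : LC 0 t
  lt = kinded-lc kd
  Kκ : K ≡ κ y
  Kκ = rep-flex-kind {As = As} (rep-lookup E₁ reps) pL yV
  h : ∀ {K'} → FvIn y K' T → K' ≡ K
  h q = trans (proj₂ (gT q) yV) (sym Kκ)
  gt : Good κ V U t
  gt q = ⊥-elim (fvin-proj (length As) i q)
  reps' : All (GoodProblem κ V U) (substP y t (E₁ ++ (L , R) ∷ E₂))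
  reps' = AllP.map⁺ (All.map (λ r → rep-substFv y t lt gt r) reps)
match-kinding {V = V} {U} (m-imi {E₁ = E₁} {E₂} {L} {R} y K As a Bs ys yV rg pL pR len uq fr kd m) κ reps T gT kT =
  match-kinding m κ' reps' (substFv y t T) (good-substFv y t lt T (good-extend ys frU gT) gt) (substFv-kinding y t lt kd T h kT)
  where
  t : Ty
  t = imiTerm (length As) a ys
  lt : LC 0 t
  lt = kinded-lc kd
  κ' : ℕ → Kind
  κ' = extendKinds ys κ
  frU : All (λ p → proj₁ p ∉ U) ys
  frU = All.map proj₁ fr
  r : GoodProblem κ V U (L , R)
  r = rep-lookup E₁ reps
  h : ∀ {K'} → FvIn y K' T → K' ≡ K
  h q = trans (proj₂ (gT q) yV) (sym (rep-flex-kind {As = As} r pL yV))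
  gt : Good κ' (map proj₁ ys ++ V) (map proj₁ ys ++ U) t
  gt = imitation-good (length As) ys uq frU rg (λ { refl → rep-rigid-head {Bs = Bs} r pR })
  reps' : All (GoodProblem κ' (map proj₁ ys ++ V) (map proj₁ ys ++ U)) (substP y t (E₁ ++ (L , R) ∷ E₂))
  reps' = AllP.map⁺ (All.map (λ r → rep-substFv y t lt gt (rep-extend ys frU r)) reps)

_≟K_ : (K K' : Kind) → Dec (K ≡ K')
⋆ ≟K ⋆ = yes refl
⋆ ≟K (⋆⇒ K') = no (λ ())
(⋆⇒ K) ≟K ⋆ = no (λ ())
(⋆⇒ K) ≟K (⋆⇒ K') with K ≟K K'
... | yes refl = yes refl
... | no p = no (λ { refl → p refl })

fresh : List ℕ → ℕ
fresh xs = suc (foldr _⊔_ 0 xs)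

fresh-≤ : ∀ {y} xs → y ∈ xs → y ≤ foldr _⊔_ 0 xs
fresh-≤ (x ∷ xs) (here refl) = m≤m⊔n x _
fresh-≤ (x ∷ xs) (there p) = ≤-trans (fresh-≤ xs p) (m≤n⊔m x _)

fresh-∉ : ∀ xs → fresh xs ∉ xs
fresh-∉ xs p = 1+n≰n (fresh-≤ xs p)

rename1 : ℕ → Kind → ℕ → NameSubst
rename1 x K x'' z K' with x ≟ z | K ≟K K'
... | yes _ | yes _ = fv x'' K
... | _ | _ = fv z K'

rename1-closed : ∀ x K x'' → ClosedSubst (rename1 x K x'')
rename1-closed x K x'' z K' with x ≟ z | K ≟K K'
... | yes _ | yes _ = lc-fv
... | yes _ | no _ = lc-fv
... | no _ | _ = lc-fv

rename1-self : ∀ x K x'' → rename1 x K x'' x K ≡ fv x'' K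
rename1-self x K x'' with x ≟ x | K ≟K K
... | yes _ | yes _ = refl
... | no p | _ = ⊥-elim (p refl)
... | yes _ | no p = ⊥-elim (p refl)

rename1-other : ∀ x K x'' z K' → x ≢ z → rename1 x K x'' z K' ≡ fv z K'
rename1-other x K x'' z K' ne with x ≟ z
... | yes p = ⊥-elim (ne p)
... | no _ = refl

rename1-kinding : ∀ {sg} x K x'' z K' → sg ︔ [] ⊢ rename1 x K x'' z K' ∶ tk K'
rename1-kinding x K x'' z K' with x ≟ z | K ≟K K'
... | yes _ | yes refl = k-fv
... | yes _ | no _ = k-fv
... | no _ | _ = k-fv

rename1-names : ∀ x K x'' {z} T → z ∈ names (substNames (rename1 x K x'') T) → z ∈ names T ⊎ (z ≡ x'' × x ∈ names T)
rename1-names x K x'' {z} T p with names-fvin (substNames (rename1 x K x'') T) p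
... | K1 , q with substNames-fvin (rename1 x K x'') T q
... | w , K0 , r , s = go (rename1 x K x'' w K0) refl s
  where
  go : ∀ u → rename1 x K x'' w K0 ≡ u → FvIn z K1 u → z ∈ names T ⊎ (z ≡ x'' × x ∈ names T)
  go u eq s' with x ≟ w | K ≟K K0
  go .(fv x'' K) refl here | yes refl | yes _ = inj₂ (refl , fvin-names T r)
  go .(fv w K0) refl here | yes _ | no _ = inj₁ (fvin-names T r)
  go .(fv w K0) refl here | no _ | _ = inj₁ (fvin-names T r)

rename1-fvin : ∀ x K x'' {K'} T → x'' ∉ names T → FvIn x'' K' (substNames (rename1 x K x'') T) → K' ≡ K
rename1-fvin x K x'' {K'} T fr q with substNames-fvin (rename1 x K x'') T q
... | w , K0 , r , s = go (rename1 x K x'' w K0) refl s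
  where
  go : ∀ u → rename1 x K x'' w K0 ≡ u → FvIn x'' K' u → K' ≡ K
  go u eq s' with x ≟ w | K ≟K K0
  go .(fv x'' K) refl here | yes refl | yes _ = refl
  go .(fv w K0) refl here | yes _ | no _ = ⊥-elim (fr (fvin-names T r))
  go .(fv w K0) refl here | no _ | _ = ⊥-elim (fr (fvin-names T r))

rename1-fresh : ∀ x K x'' T → x ∉ names T → substNames (rename1 x K x'') T ≡ T
rename1-fresh x K x'' T p = substNames-id _ T (λ {z} {K'} q → rename1-other x K x'' z K' (λ { refl → p (fvin-names T q) }))

renameE : NameSubst → Ev → Ev
renameE f (var α) = var α
renameE f (cst κ) = cst κ
renameE f (lamE α e) = lamE α (renameE f e)
renameE f (appE e e') = appE (renameE f e) (renameE f e')
renameE f (mu α e) = mu α (renameE f e)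
renameE f (tapp e T) = tapp (renameE f e) (substNames f T)
renameE f (tlam e) = tlam (renameE f e)

renameC : NameSubst → Ctx → Ctx
renameC f Γ = map (λ p → proj₁ p , substNames f (proj₂ p)) Γ

renameE-substE : ∀ f → ClosedSubst f → ∀ k U e → renameE f (substE k U e) ≡ substE k (substNames f U) (renameE f e)
renameE-substE f cl k U (var x) = refl
renameE-substE f cl k U (cst x) = refl
renameE-substE f cl k U (lamE x e) = cong (lamE x) (renameE-substE f cl k U e)
renameE-substE f cl k U (appE e e₁) = cong₂ appE (renameE-substE f cl k U e) (renameE-substE f cl k U e₁)
renameE-substE f cl k U (mu x e) = cong (mu x) (renameE-substE f cl k U e)
renameE-substE f cl k U (tapp e T) = cong₂ tapp (renameE-substE f cl k U e) (substNames-subst f cl k U T)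
renameE-substE f cl k U (tlam e) rewrite renameE-substE f cl (suc k) (shift 0 U) e | substNames-shift f cl 0 U = refl

erase-renameE : ∀ f e → erase (renameE f e) ≡ erase e
erase-renameE f (var x) = refl
erase-renameE f (cst x) = refl
erase-renameE f (lamE x e) = cong (lamE x) (erase-renameE f e)
erase-renameE f (appE e e₁) = cong₂ appE (erase-renameE f e) (erase-renameE f e₁)
erase-renameE f (mu x e) = cong (mu x) (erase-renameE f e)
erase-renameE f (tapp e x) = erase-renameE f e
erase-renameE f (tlam e) = erase-renameE f e

renameC-∋ : ∀ f {Γ h T} → Γ ∋ h ∶ T → renameC f Γ ∋ h ∶ substNames f T
renameC-∋ f here = here
renameC-∋ f (there ne p) = there ne (renameC-∋ f p)

renameE-names : ∀ x K x'' {z} e → z ∈ namesE (renameE (rename1 x K x'') e) → z ∈ namesE e ⊎ (z ≡ x'' × x ∈ namesE e)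
renameE-names x K x'' (lamE _ e) p = renameE-names x K x'' e p
renameE-names x K x'' (appE e e') p with ∈-++⁻ (namesE (renameE (rename1 x K x'') e)) p
... | inj₁ q with renameE-names x K x'' e q
...   | inj₁ r = inj₁ (∈-++⁺ˡ r)
...   | inj₂ (a , r) = inj₂ (a , ∈-++⁺ˡ r)
renameE-names x K x'' (appE e e') p | inj₂ q with renameE-names x K x'' e' q
...   | inj₁ r = inj₁ (∈-++⁺ʳ (namesE e) r)
...   | inj₂ (a , r) = inj₂ (a , ∈-++⁺ʳ (namesE e) r)
renameE-names x K x'' (mu _ e) p = renameE-names x K x'' e p
renameE-names x K x'' (tapp e T) p with ∈-++⁻ (namesE (renameE (rename1 x K x'') e)) p
... | inj₁ q with renameE-names x K x'' e q
...   | inj₁ r = inj₁ (∈-++⁺ˡ r)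
...   | inj₂ (a , r) = inj₂ (a , ∈-++⁺ˡ r)
renameE-names x K x'' (tapp e T) p | inj₂ q with rename1-names x K x'' T q
...   | inj₁ r = inj₁ (∈-++⁺ʳ (namesE e) r)
...   | inj₂ (a , r) = inj₂ (a , ∈-++⁺ʳ (namesE e) r)
renameE-names x K x'' (tlam e) p = renameE-names x K x'' e p

renameC-names : ∀ x K x'' {z} Γ → z ∈ namesCtx (renameC (rename1 x K x'') Γ) → z ∈ namesCtx Γ ⊎ (z ≡ x'' × x ∈ namesCtx Γ)
renameC-names x K x'' ((h , T) ∷ Γ) p with ∈-++⁻ (names (substNames (rename1 x K x'') T)) p
... | inj₁ q with rename1-names x K x'' T q
...   | inj₁ r = inj₁ (∈-++⁺ˡ r)
...   | inj₂ (a , r) = inj₂ (a , ∈-++⁺ˡ r)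
renameC-names x K x'' ((h , T) ∷ Γ) p | inj₂ q with renameC-names x K x'' Γ q
...   | inj₁ r = inj₁ (∈-++⁺ʳ (names T) r)
...   | inj₂ (a , r) = inj₂ (a , ∈-++⁺ʳ (names T) r)

renameC-fresh : ∀ x K x'' Γ → x ∉ namesCtx Γ → renameC (rename1 x K x'') Γ ≡ Γ
renameC-fresh x K x'' [] p = refl
renameC-fresh x K x'' ((h , T) ∷ Γ) p = cong₂ _∷_ (cong (h ,_) (rename1-fresh x K x'' T (λ q → p (∈-++⁺ˡ q)))) (renameC-fresh x K x'' Γ (λ q → p (∈-++⁺ʳ (names T) q)))

-- All names bound by type abstractions in a derivation, with the names
-- around them: a name outside this list can serve as a renaming target.
namesDeriv : ∀ {sg Γ e T} → sg ∣ Γ ⊢ e ∶ T → List ℕ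
namesDeriv (t-hd x) = []
namesDeriv (t-app d d₁) = namesDeriv d ++ namesDeriv d₁
namesDeriv (t-lam d) = namesDeriv d
namesDeriv (t-mu d) = namesDeriv d
namesDeriv (t-inst d x) = namesDeriv d
namesDeriv (t-abs {Γ} {e} {K} {T} x _ _ _ d) = x ∷ (namesCtx Γ ++ namesE e ++ names T ++ namesDeriv d)
namesDeriv (t-conv d x x₁) = namesDeriv d

rename1-fv : ∀ x K x'' w K0 → ∃ λ w' → (rename1 x K x'' w K0 ≡ fv w' K0) × ((w' ≡ x'' × w ≡ x) ⊎ w' ≡ w)
rename1-fv x K x'' w K0 with x ≟ w | K ≟K K0
... | yes refl | yes refl = x'' , refl , inj₁ (refl , refl)
... | yes _ | no _ = w , refl , inj₂ refl
... | no _ | yes _ = w , refl , inj₂ refl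
... | no _ | no _ = w , refl , inj₂ refl

fresh-after-rename : ∀ {x x'' w w' : ℕ} (ns ns' : List ℕ) →
  (∀ {z} → z ∈ ns' → z ∈ ns ⊎ (z ≡ x'' × x ∈ ns)) →
  w ∉ ns → x'' ∉ ns → x'' ≢ w → ((w' ≡ x'' × w ≡ x) ⊎ w' ≡ w) → w' ∉ ns'
fresh-after-rename ns ns' tr wn xn ne (inj₁ (refl , refl)) p with tr p
... | inj₁ q = xn q
... | inj₂ (_ , q) = wn q
fresh-after-rename ns ns' tr wn xn ne (inj₂ refl) p with tr p
... | inj₁ q = wn q
... | inj₂ (refl , q) = ne refl

rename-typing : ∀ {sg} x K x'' {Γ e T} (d : sg ∣ Γ ⊢ e ∶ T) → x'' ∉ namesDeriv d →
  sg ∣ renameC (rename1 x K x'') Γ ⊢ renameE (rename1 x K x'') e ∶ substNames (rename1 x K x'') T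
rename-typing x K x'' (t-hd {h = evar α} p) fr = t-hd {h = evar α} (renameC-∋ _ p)
rename-typing x K x'' (t-hd {h = econ c} p) fr = t-hd {h = econ c} (renameC-∋ _ p)
rename-typing x K x'' (t-app d d₁) fr =
  t-app (rename-typing x K x'' d (λ q → fr (∈-++⁺ˡ q))) (rename-typing x K x'' d₁ (λ q → fr (∈-++⁺ʳ (namesDeriv d) q)))
rename-typing x K x'' (t-lam d) fr = t-lam (rename-typing x K x'' d fr)
rename-typing x K x'' (t-mu d) fr = t-mu (rename-typing x K x'' d fr)
rename-typing x K x'' (t-inst {T = T} {T' = T'} d k) fr rewrite substNames-subst (rename1 x K x'') (rename1-closed x K x'') 0 T' T =
  t-inst (rename-typing x K x'' d fr) (substNames-kinding _ k (λ {z} {K'} _ → rename1-kinding x K x'' z K'))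
rename-typing x K x'' (t-abs {Γ} {e} {K0} {T} w wΓ we wT d) fr with rename1-fv x K x'' w K0
... | w' , eq , cs =
  t-abs w' (stays-fresh (renameC-names x K x'' Γ) wΓ fr-Γ) (stays-fresh (renameE-names x K x'' e) we fr-e)
    (stays-fresh (rename1-names x K x'' T) wT fr-T) d'
  where
  fr-Γ : x'' ∉ namesCtx Γ
  fr-Γ q = fr (there (∈-++⁺ˡ q))
  fr-e : x'' ∉ namesE e
  fr-e q = fr (there (∈-++⁺ʳ (namesCtx Γ) (∈-++⁺ˡ q)))
  fr-T : x'' ∉ names T
  fr-T q = fr (there (∈-++⁺ʳ (namesCtx Γ) (∈-++⁺ʳ (namesE e) (∈-++⁺ˡ q))))
  fr-d : x'' ∉ namesDeriv d
  fr-d q = fr (there (∈-++⁺ʳ (namesCtx Γ) (∈-++⁺ʳ (namesE e) (∈-++⁺ʳ (names T) q))))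
  stays-fresh : ∀ {ns ns'} → (∀ {z} → z ∈ ns' → z ∈ ns ⊎ (z ≡ x'' × x ∈ ns)) → w ∉ ns → x'' ∉ ns → w' ∉ ns'
  stays-fresh tr w∉ x''∉ = fresh-after-rename _ _ tr w∉ x''∉ (λ { refl → fr (here refl) }) cs
  d' : _ ∣ renameC (rename1 x K x'') Γ ⊢ substE 0 (fv w' K0) (renameE (rename1 x K x'') e) ∶ subst0 (fv w' K0) (substNames (rename1 x K x'') T)
  d' rewrite sym eq
      | sym (renameE-substE (rename1 x K x'') (rename1-closed x K x'') 0 (fv w K0) e)
      | sym (substNames-subst (rename1 x K x'') (rename1-closed x K x'') 0 (fv w K0) T) = rename-typing x K x'' d fr-d
rename-typing x K x'' (t-conv d c (S , k)) fr =
  t-conv (rename-typing x K x'' d fr) (substNames-↔o* _ (rename1-closed x K x'') c)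
    (S , substNames-kinding _ k (λ {z} {K'} _ → rename1-kinding x K x'' z K'))

closeT : ℕ → ℕ → Ty → Ty
closeT k x (con F) = con F
closeT k x (fv y K) with x ≟ y
... | yes _ = bv k
... | no _ = fv y K
closeT k x (bv i) = shift k (bv i)
closeT k x (lam T) = lam (closeT (suc k) x T)
closeT k x (all K T) = all K (closeT (suc k) x T)
closeT k x (app T U) = app (closeT k x T) (closeT k x U)
closeT k x (T ⇒ U) = closeT k x T ⇒ closeT k x U

open-closeT : ∀ k x K T → (∀ {K'} → FvIn x K' T → K' ≡ K) → substAt k (fv x K) (closeT k x T) ≡ T
open-closeT k x K (con F) h = refl
open-closeT k x K (fv y K') h with x ≟ y
... | yes refl rewrite h here = subst-here {k}
... | no _ = refl
open-closeT k x K (bv i) h with <-cmp i k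
... | tri< a _ _ rewrite shift-below {k} a = subst-below a
... | tri≈ _ refl _ rewrite shift-above {i} {i} ≤-refl = subst-above {i} {suc i} ≤-refl
... | tri> _ _ c rewrite shift-above {k} {i} (<⇒≤ c) = subst-above {k} {suc i} (m<n⇒m<1+n c)
open-closeT k x K (lam T) h = cong lam (open-closeT (suc k) x K T (λ q → h (i-lam q)))
open-closeT k x K (all K₁ T) h = cong (all K₁) (open-closeT (suc k) x K T (λ q → h (i-all q)))
open-closeT k x K (app T U) h = cong₂ app (open-closeT k x K T (λ q → h (i-appˡ q))) (open-closeT k x K U (λ q → h (i-appʳ q)))
open-closeT k x K (T ⇒ U) h = cong₂ _⇒_ (open-closeT k x K T (λ q → h (i-arrˡ q))) (open-closeT k x K U (λ q → h (i-arrʳ q)))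

closeT-removes : ∀ k x T → x ∉ names (closeT k x T)
closeT-removes k x (fv y K) p with x ≟ y
closeT-removes k x (fv y K) () | yes _
closeT-removes k x (fv y K) (here refl) | no q = q refl
closeT-removes k x (bv i) p with i <? k
closeT-removes k x (bv i) () | yes _
closeT-removes k x (bv i) () | no _
closeT-removes k x (lam T) p = closeT-removes (suc k) x T p
closeT-removes k x (all K T) p = closeT-removes (suc k) x T p
closeT-removes k x (app T U) p with ∈-++⁻ (names (closeT k x T)) p
... | inj₁ q = closeT-removes k x T q
... | inj₂ q = closeT-removes k x U q
closeT-removes k x (T ⇒ U) p with ∈-++⁻ (names (closeT k x T)) p
... | inj₁ q = closeT-removes k x T q
... | inj₂ q = closeT-removes k x U q

closeE : ℕ → ℕ → Ev → Ev
closeE k x (var α) = var α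
closeE k x (cst c) = cst c
closeE k x (lamE α e) = lamE α (closeE k x e)
closeE k x (appE e e') = appE (closeE k x e) (closeE k x e')
closeE k x (mu α e) = mu α (closeE k x e)
closeE k x (tapp e T) = tapp (closeE k x e) (closeT k x T)
closeE k x (tlam e) = tlam (closeE (suc k) x e)

KindOKE : (Ty → Set) → Ev → Set
KindOKE P (var α) = ⊤
KindOKE P (cst c) = ⊤
KindOKE P (lamE α e) = KindOKE P e
KindOKE P (appE e e') = KindOKE P e × KindOKE P e'
KindOKE P (mu α e) = KindOKE P e
KindOKE P (tapp e T) = KindOKE P e × P T
KindOKE P (tlam e) = KindOKE P e

open-closeE : ∀ k x K e → KindOKE (λ T → ∀ {K'} → FvIn x K' T → K' ≡ K) e → substE k (fv x K) (closeE k x e) ≡ e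
open-closeE k x K (var x₁) ok = refl
open-closeE k x K (cst x₁) ok = refl
open-closeE k x K (lamE x₁ e) ok = cong (lamE x₁) (open-closeE k x K e ok)
open-closeE k x K (appE e e₁) (o1 , o2) = cong₂ appE (open-closeE k x K e o1) (open-closeE k x K e₁ o2)
open-closeE k x K (mu x₁ e) ok = cong (mu x₁) (open-closeE k x K e ok)
open-closeE k x K (tapp e T) (o1 , o2) = cong₂ tapp (open-closeE k x K e o1) (open-closeT k x K T o2)
open-closeE k x K (tlam e) ok = cong tlam (open-closeE (suc k) x K e ok)

closeE-removes : ∀ k x e → x ∉ namesE (closeE k x e)
closeE-removes k x (lamE _ e) p = closeE-removes k x e p
closeE-removes k x (appE e e') p with ∈-++⁻ (namesE (closeE k x e)) p
... | inj₁ q = closeE-removes k x e q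
... | inj₂ q = closeE-removes k x e' q
closeE-removes k x (mu _ e) p = closeE-removes k x e p
closeE-removes k x (tapp e T) p with ∈-++⁻ (namesE (closeE k x e)) p
... | inj₁ q = closeE-removes k x e q
... | inj₂ q = closeT-removes k x T q
closeE-removes k x (tlam e) p = closeE-removes (suc k) x e p

erase-closeE : ∀ k x e → erase (closeE k x e) ≡ erase e
erase-closeE k x (var x₁) = refl
erase-closeE k x (cst x₁) = refl
erase-closeE k x (lamE x₁ e) = cong (lamE x₁) (erase-closeE k x e)
erase-closeE k x (appE e e₁) = cong₂ appE (erase-closeE k x e) (erase-closeE k x e₁)
erase-closeE k x (mu x₁ e) = cong (mu x₁) (erase-closeE k x e)
erase-closeE k x (tapp e x₁) = erase-closeE k x e
erase-closeE k x (tlam e) = erase-closeE (suc k) x e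

renameE-kindOK : ∀ x K x'' e → x'' ∉ namesE e → KindOKE (λ T → ∀ {K'} → FvIn x'' K' T → K' ≡ K) (renameE (rename1 x K x'') e)
renameE-kindOK x K x'' (var x₁) fr = tt
renameE-kindOK x K x'' (cst x₁) fr = tt
renameE-kindOK x K x'' (lamE x₁ e) fr = renameE-kindOK x K x'' e fr
renameE-kindOK x K x'' (appE e e₁) fr = renameE-kindOK x K x'' e (λ q → fr (∈-++⁺ˡ q)) , renameE-kindOK x K x'' e₁ (λ q → fr (∈-++⁺ʳ (namesE e) q))
renameE-kindOK x K x'' (mu x₁ e) fr = renameE-kindOK x K x'' e fr
renameE-kindOK x K x'' (tapp e T) fr = renameE-kindOK x K x'' e (λ q → fr (∈-++⁺ˡ q)) , (λ q → rename1-fvin x K x'' T (λ r → fr (∈-++⁺ʳ (namesE e) r)) q)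
renameE-kindOK x K x'' (tlam e) fr = renameE-kindOK x K x'' e fr

-- The
-- name x is first renamed to one fresh for the whole derivation, so that
-- t-abs applies.
∀-intro : ∀ {sg Γ e1 x K W} → sg ∣ Γ ⊢ e1 ∶ subst0 (fv x K) W → x ∉ namesCtx Γ → x ∉ names W →
  ∃ λ e0 → (sg ∣ Γ ⊢ e0 ∶ all K W) × (erase e0 ≡ erase e1)
∀-intro {sg} {Γ} {e1} {x} {K} {W} d xΓ xW =
  tlam (closeE 0 x'' (renameE ρ e1)) ,
  t-abs x'' (λ q → fr (∈-++⁺ʳ (namesDeriv d) (∈-++⁺ˡ q))) (closeE-removes 0 x'' (renameE ρ e1))
    (λ q → fr (∈-++⁺ʳ (namesDeriv d) (∈-++⁺ʳ (namesCtx Γ) (∈-++⁺ʳ (namesE e1) q)))) d'' ,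
  trans (erase-closeE 0 x'' (renameE ρ e1)) (erase-renameE ρ e1)
  where
  ns : List ℕ
  ns = namesDeriv d ++ namesCtx Γ ++ namesE e1 ++ names W
  x'' : ℕ
  x'' = fresh ns
  fr : x'' ∉ ns
  fr = fresh-∉ ns
  ρ : NameSubst
  ρ = rename1 x K x''
  d1 : sg ∣ renameC ρ Γ ⊢ renameE ρ e1 ∶ substNames ρ (subst0 (fv x K) W)
  d1 = rename-typing x K x'' d (λ q → fr (∈-++⁺ˡ q))
  eqT : substNames ρ (subst0 (fv x K) W) ≡ subst0 (fv x'' K) W
  eqT rewrite substNames-subst ρ (rename1-closed x K x'') 0 (fv x K) W
      | rename1-self x K x''
      | rename1-fresh x K x'' W xW = refl
  d'' : sg ∣ Γ ⊢ substE 0 (fv x'' K) (closeE 0 x'' (renameE ρ e1)) ∶ subst0 (fv x'' K) W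
  d'' rewrite open-closeE 0 x'' K (renameE ρ e1) (renameE-kindOK x K x'' e1 (λ q → fr (∈-++⁺ʳ (namesDeriv d) (∈-++⁺ʳ (namesCtx Γ) (∈-++⁺ˡ q))))) =
    subst₂ (λ G T → sg ∣ G ⊢ renameE ρ e1 ∶ T) (renameC-fresh x K x'' Γ xΓ) eqT d1

substAt-alls : ∀ k x K Ks T → ∃ λ T' → substAt k (fv x K) (alls Ks T) ≡ alls Ks T'
substAt-alls k x K [] T = _ , refl
substAt-alls k x K (K' ∷ Ks) T with substAt-alls (suc k) x K Ks T
... | T' , eq = T' , cong (all K') eq

lookupK-split : ∀ Ψ₁ {Ψ₂ K} i {K'} → lookupK (Ψ₁ ++ K ∷ Ψ₂) i ≡ just K' →
  (i < length Ψ₁ × lookupK (Ψ₁ ++ Ψ₂) i ≡ just K') ⊎ (i ≡ length Ψ₁ × K' ≡ K) ⊎ (length Ψ₁ < i × lookupK (Ψ₁ ++ Ψ₂) (pred i) ≡ just K')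
lookupK-split [] zero refl = inj₂ (inj₁ (refl , refl))
lookupK-split [] (suc i) p = inj₂ (inj₂ (s≤s z≤n , p))
lookupK-split (K0 ∷ Ψ₁) zero p = inj₁ (s≤s z≤n , p)
lookupK-split (K0 ∷ Ψ₁) {Ψ₂} (suc i) p with lookupK-split Ψ₁ {Ψ₂} i p
... | inj₁ (a , b) = inj₁ (s≤s a , b)
... | inj₂ (inj₁ (refl , b)) = inj₂ (inj₁ (refl , b))
lookupK-split (K0 ∷ Ψ₁) {Ψ₂} (suc (suc i)) p | inj₂ (inj₂ (a , b)) = inj₂ (inj₂ (s≤s a , b))

occ-substAt : ∀ {m k U T} → m < k → Occ m T → Occ m (substAt k U T)
occ-substAt {m} {k} {U} lt (here {k = .m}) rewrite subst-below {k} {m} {U} lt = here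
occ-substAt lt (lam q) = lam (occ-substAt (s≤s lt) q)
occ-substAt lt (all q) = all (occ-substAt (s≤s lt) q)
occ-substAt lt (appˡ q) = appˡ (occ-substAt lt q)
occ-substAt lt (appʳ q) = appʳ (occ-substAt lt q)
occ-substAt lt (arrˡ q) = arrˡ (occ-substAt lt q)
occ-substAt lt (arrʳ q) = arrʳ (occ-substAt lt q)

kinding-open : ∀ {sg} Ψ₁ {Ψ₂ K T S} x → sg ︔ (Ψ₁ ++ K ∷ Ψ₂) ⊢ T ∶ S → sg ︔ (Ψ₁ ++ Ψ₂) ⊢ substAt (length Ψ₁) (fv x K) T ∶ S
kinding-open Ψ₁ x k-con = k-con
kinding-open Ψ₁ x k-fv = k-fv
kinding-open Ψ₁ {Ψ₂} {K} x (k-bv {i = i} p) with lookupK-split Ψ₁ {Ψ₂} i p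
... | inj₁ (a , b) rewrite subst-below {length Ψ₁} {i} {fv x K} a = k-bv b
... | inj₂ (inj₁ (refl , refl)) rewrite subst-here {length Ψ₁} {fv x K} = k-fv
... | inj₂ (inj₂ (a , b)) rewrite subst-above {length Ψ₁} {i} {fv x K} a = k-bv b
kinding-open Ψ₁ x (k-lam k oc) = k-lam (kinding-open (⋆ ∷ Ψ₁) x k) (occ-substAt (s≤s z≤n) oc)
kinding-open Ψ₁ x (k-all {K = K'} k p) = k-all (kinding-open (K' ∷ Ψ₁) x k) p
kinding-open Ψ₁ x (k-app k k₁) = k-app (kinding-open Ψ₁ x k) (kinding-open Ψ₁ x k₁)
kinding-open Ψ₁ x (k-arr k p k₁ p₁) = k-arr (kinding-open Ψ₁ x k) p (kinding-open Ψ₁ x k₁) p₁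

wk-instAlls : ∀ {sg} xs T → WK sg T → WK sg (instAlls xs T)
wk-instAlls [] T w = w
wk-instAlls (x ∷ xs) (all K T) (.o , k-all k p) = wk-instAlls xs _ (_ , kinding-open [] x k)
wk-instAlls (x ∷ xs) (con _) w = w
wk-instAlls (x ∷ xs) (fv _ _) w = w
wk-instAlls (x ∷ xs) (bv _) w = w
wk-instAlls (x ∷ xs) (lam _) w = w
wk-instAlls (x ∷ xs) (app _ _) w = w
wk-instAlls (x ∷ xs) (_ ⇒ _) w = w

wk-arrows : ∀ {sg} Ts B → WK sg (arrows Ts B) → All (WK sg) Ts × WK sg B
wk-arrows [] B w = [] , w
wk-arrows (T ∷ Ts) B (.o , k-arr k1 _ k2 _) with wk-arrows Ts B (_ , k2)
... | a , b = ((_ , k1) ∷ a) , b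

fvin-instAlls : ∀ {z K'} xs Ks T → length xs ≡ length Ks → FvIn z K' (instAlls xs (alls Ks T)) →
  FvIn z K' (alls Ks T) ⊎ (z , K') ∈ zip xs Ks
fvin-instAlls [] [] T e p = inj₁ p
fvin-instAlls (x ∷ xs) (K ∷ Ks) T e p with substAt-alls 0 x K Ks T
... | T' , eq with fvin-instAlls xs Ks T' (suc-injective e) (subst (λ z → FvIn _ _ (instAlls xs z)) eq p)
... | inj₂ q = inj₂ (there q)
... | inj₁ q with fvin-subst 0 (fv x K) (alls Ks T) (subst (FvIn _ _) (sym eq) q)
...   | inj₁ here = inj₂ (here refl)
...   | inj₂ r = inj₁ (i-all r)

applyS-all : ∀ σ → ClosedS σ → ∀ K W → applyS σ (all K W) ≡ all K (applyS σ W)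
applyS-all [] l K W = refl
applyS-all ((y , t) ∷ σ) (l ∷ ls) K W rewrite lc-sh {c = 0} z≤n l = applyS-all σ ls K (substFv y t W)

applyS-subst0 : ∀ σ → ClosedS σ → ∀ U W → applyS σ (subst0 U W) ≡ subst0 (applyS σ U) (applyS σ W)
applyS-subst0 [] l U W = refl
applyS-subst0 ((y , t) ∷ σ) (l ∷ ls) U W rewrite substFv≡substNames y t l (subst0 U W)
    | substNames-subst (single y t) (single-closed y t l) 0 U W
  | sym (substFv≡substNames y t l U) | sym (substFv≡substNames y t l W) = applyS-subst0 σ ls (substFv y t U) (substFv y t W)

substFv-arrows : ∀ y t Ts B → substFv y t (arrows Ts B) ≡ arrows (map (substFv y t) Ts) (substFv y t B)
substFv-arrows y t [] B = refl
substFv-arrows y t (T ∷ Ts) B = cong (substFv y t T ⇒_) (substFv-arrows y t Ts B)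

applyS-arrows : ∀ σ Ts B → applyS σ (arrows Ts B) ≡ arrows (map (applyS σ) Ts) (applyS σ B)
applyS-arrows [] Ts B = cong (λ z → arrows z B) (sym (map-id Ts))
applyS-arrows ((y , t) ∷ σ) Ts B rewrite substFv-arrows y t Ts B = trans (applyS-arrows σ (map (substFv y t) Ts) (substFv y t B)) (cong (λ z → arrows z _) (sym (map-∘ Ts)))

tappsE : Ev → List Ty → Ev
tappsE e [] = e
tappsE e (t ∷ ts) = tappsE (tapp e t) ts

instType : Subst → ℕ × Kind → Ty
instType σ p = applyS σ (fv (proj₁ p) (proj₂ p))

tapps-typing : ∀ {sg Γ} σ → ClosedS σ → ∀ xs Ks body e → length xs ≡ length Ks →
  (∀ {x K} → (x , K) ∈ zip xs Ks → sg ︔ [] ⊢ applyS σ (fv x K) ∶ tk K) →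
  sg ∣ Γ ⊢ e ∶ applyS σ (alls Ks body) →
  sg ∣ Γ ⊢ tappsE e (map (instType σ) (zip xs Ks)) ∶ applyS σ (instAlls xs (alls Ks body))
tapps-typing σ l [] [] body e len hk d = d
tapps-typing {sg} {Γ} σ l (x ∷ xs) (K ∷ Ks) body e len hk d with substAt-alls 0 x K Ks body
... | body' , eq = subst (λ z → sg ∣ Γ ⊢ tappsE (tapp e (instType σ (x , K))) (map (instType σ) (zip xs Ks)) ∶ applyS σ (instAlls xs z)) (sym eq)
      (tapps-typing σ l xs Ks body' (tapp e (instType σ (x , K))) (suc-injective len) (λ q → hk (there q)) d2)
  where
  d1 : sg ∣ Γ ⊢ tapp e (instType σ (x , K)) ∶ subst0 (applyS σ (fv x K)) (applyS σ (alls Ks body))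
  d1 = t-inst (subst (λ z → sg ∣ Γ ⊢ e ∶ z) (applyS-all σ l K (alls Ks body)) d) (hk (here refl))
  d2 : sg ∣ Γ ⊢ tapp e (instType σ (x , K)) ∶ applyS σ (alls Ks body')
  d2 = subst (λ z → sg ∣ Γ ⊢ tapp e (instType σ (x , K)) ∶ z) (trans (sym (applyS-subst0 σ l (fv x K) (alls Ks body))) (cong (applyS σ) eq)) d1

apps-typing : ∀ {sg Γ} e es' Us C → sg ∣ Γ ⊢ e ∶ arrows Us C → Pointwise (λ e' U → sg ∣ Γ ⊢ e' ∶ U) es' Us → sg ∣ Γ ⊢ appsE e es' ∶ C
apps-typing e [] [] C d [] = d
apps-typing e (e' ∷ es') (U ∷ Us) C d (p ∷ ps) = apps-typing (appE e e') es' Us C (t-app p d) ps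

erase-appsE : ∀ e es → erase (appsE e es) ≡ appsE (erase e) (map erase es)
erase-appsE e [] = refl
erase-appsE e (e' ∷ es) = erase-appsE (appE e e') es

erase-tappsE : ∀ e ts → erase (tappsE e ts) ≡ erase e
erase-tappsE e [] = refl
erase-tappsE e (t ∷ ts) = erase-tappsE (tapp e t) ts

erase-hd : ∀ h → erase (hdEv h) ≡ hdEv h
erase-hd (evar x) = refl
erase-hd (econ x) = refl

curry-appsE : ∀ e es → Curry (appsE e es) → Curry e × All Curry es
curry-appsE e [] c = c , []
curry-appsE e (e' ∷ es) c with curry-appsE (appE e e') es c
... | cu-app c1 c2 , cs = c1 , (c2 ∷ cs)

lamsE-typing : ∀ {sg} Γ ds e A → sg ∣ extend Γ ds ⊢ e ∶ A → sg ∣ Γ ⊢ lamsE ds e ∶ arrows (map proj₂ ds) A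
lamsE-typing Γ [] e A d = d
lamsE-typing Γ ((α , T) ∷ ds) e A d = t-lam (lamsE-typing ((evar α , T) ∷ Γ) ds e A d)

erase-lamsE : ∀ ds e → erase (lamsE ds e) ≡ lamsE ds (erase e)
erase-lamsE [] e = refl
erase-lamsE ((α , T) ∷ ds) e = cong (lamE α) (erase-lamsE ds e)

curry-lamsE : ∀ ds e → Curry (lamsE ds e) → Curry e
curry-lamsE [] e c = c
curry-lamsE ((α , T) ∷ ds) e (cu-lam c) = curry-lamsE ds e c

wk-extend : ∀ {sg} Γ ds → All (λ d → WK sg (proj₂ d)) Γ → All (WK sg) (map proj₂ ds) → All (λ d → WK sg (proj₂ d)) (extend Γ ds)
wk-extend Γ [] a b = a
wk-extend Γ ((α , T) ∷ ds) a (w ∷ b) = wk-extend ((evar α , T) ∷ Γ) ds (w ∷ a) b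

lookup-ctx : ∀ {P : Hd × Ty → Set} {Γ h S} → All P Γ → Γ ∋ h ∶ S → P (h , S)
lookup-ctx (p ∷ ps) here = p
lookup-ctx (p ∷ ps) (there _ q) = lookup-ctx ps q

names-lookup : ∀ {Γ h S z} → Γ ∋ h ∶ S → z ∈ names S → z ∈ namesCtx Γ
names-lookup here p = ∈-++⁺ˡ p
names-lookup {(_ , T) ∷ Γ} (there _ q) p = ∈-++⁺ʳ (names T) (names-lookup q p)

names-in-Φ : ∀ Φ₁ {Φ₂ Γ e T z} → z ∈ namesCtx Γ ++ namesE e ++ names T → z ∈ namesΦ (Φ₁ ++ (Γ , e , T) ∷ Φ₂)
names-in-Φ [] p = ∈-++⁺ˡ p
names-in-Φ (t ∷ Φ₁) p = ∈-++⁺ʳ _ (names-in-Φ Φ₁ p)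

fresh-in-triple : ∀ Φ₁ {Φ₂ Γ e T x} → x ∉ namesΦ (Φ₁ ++ (Γ , e , T) ∷ Φ₂) → x ∉ namesCtx Γ × x ∉ names T
fresh-in-triple Φ₁ {Γ = Γ} {e} x∉ =
  (λ p → x∉ (names-in-Φ Φ₁ (∈-++⁺ˡ p))) , (λ p → x∉ (names-in-Φ Φ₁ (∈-++⁺ʳ (namesCtx Γ) (∈-++⁺ʳ (namesE e) p))))

names-open : ∀ {z} k x K W → z ∈ names (substAt k (fv x K) W) → z ∈ names W ⊎ z ≡ x
names-open k x K W p with names-fvin (substAt k (fv x K) W) p
... | K' , q with fvin-subst k (fv x K) W q
... | inj₁ here = inj₂ refl
... | inj₂ r = inj₁ (fvin-names W r)

∀*-intro : ∀ {sg Γ} xs Ks T {e1} → length xs ≡ length Ks → Unique xs →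
  All (λ x → x ∉ namesCtx Γ × x ∉ names (alls Ks T)) xs → sg ∣ Γ ⊢ e1 ∶ instAlls xs (alls Ks T) →
  ∃ λ e0 → (sg ∣ Γ ⊢ e0 ∶ alls Ks T) × (erase e0 ≡ erase e1)
∀*-intro [] [] T len u fr d = _ , d , refl
∀*-intro {sg} {Γ} (x ∷ xs) (K ∷ Ks) T {e1} len (ux ∷ uxs) ((xΓ , xT) ∷ fr) d with substAt-alls 0 x K Ks T
... | T' , eq with ∀*-intro xs Ks T' (suc-injective len) uxs (fr' xs ux fr) (subst (λ z → sg ∣ Γ ⊢ e1 ∶ instAlls xs z) eq d)
  where
  fr' : ∀ ys → All (x ≢_) ys → All (λ y → y ∉ namesCtx Γ × y ∉ names (alls (K ∷ Ks) T)) ys → All (λ y → y ∉ namesCtx Γ × y ∉ names (alls Ks T')) ys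
  fr' [] _ [] = []
  fr' (y ∷ ys) (ne ∷ nes) ((yΓ , yT) ∷ f) = (yΓ , λ q → h (names-open 0 x K (alls Ks T) (subst (λ z → y ∈ names z) (sym eq) q))) ∷ fr' ys nes f
    where
    h : y ∈ names (alls Ks T) ⊎ y ≡ x → ⊥
    h (inj₁ r) = yT r
    h (inj₂ refl) = ne refl
... | e0' , d0' , er with ∀-intro {sg} {Γ} {e0'} {x} {K} {alls Ks T} (subst (λ z → sg ∣ Γ ⊢ e0' ∶ z) (sym eq) d0') xΓ xT
...   | e0 , d0 , er2 = e0 , d0 , trans er2 er

map-proj₁-zip : ∀ {A B : Set} (xs : List A) (ys : List B) → length xs ≡ length ys → map proj₁ (zip xs ys) ≡ xs
map-proj₁-zip [] [] e = refl
map-proj₁-zip (x ∷ xs) (y ∷ ys) e = cong (x ∷_) (map-proj₁-zip xs ys (suc-injective e))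

zip-in₁ : ∀ {A B : Set} {x : A} {y : B} xs ys → (x , y) ∈ zip xs ys → x ∈ xs
zip-in₁ (x ∷ xs) (y ∷ ys) (here refl) = here refl
zip-in₁ (x ∷ xs) (y ∷ ys) (there p) = there (zip-in₁ xs ys p)

good-arrows : ∀ {κ V U} Ts B → Good κ V U (arrows Ts B) → All (Good κ V U) Ts × Good κ V U B
good-arrows [] B g = [] , g
good-arrows (T ∷ Ts) B g with good-arrows Ts B (λ q → g (i-arrʳ q))
... | a , b = (λ q → g (i-arrˡ q)) ∷ a , b

collect-realisations : ∀ {sg Γ} σ es Ts → length Ts ≡ length es →
  All (λ p → ∃ λ e' → (sg ∣ Γ ⊢ e' ∶ applyS σ (proj₂ p)) × (erase e' ≡ proj₁ p)) (zip es Ts) →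
  ∃ λ es' → Pointwise (λ e' U → sg ∣ Γ ⊢ e' ∶ U) es' (map (applyS σ) Ts) × (map erase es' ≡ es)
collect-realisations σ [] [] len [] = [] , [] , refl
collect-realisations σ (e ∷ es) (T ∷ Ts) len ((e' , d , er) ∷ a) with collect-realisations σ es Ts (suc-injective len) a
... | es' , pw , ers = e' ∷ es' , d ∷ pw , cong₂ _∷_ er ers

module _ (sg : Sig) where

  Inv : Triple → Set
  Inv (Γ , e , T) = Curry e × All (λ d → WK sg (proj₂ d)) Γ × WK sg T

  Realised : Triple → Set
  Realised (Γ , e , T) = ∃ λ e' → (sg ∣ Γ ⊢ e' ∶ T) × (erase e' ≡ e)

  LocallySound : Triple → List Triple → Set
  LocallySound t ts = Inv t → All Inv ts × (All Realised ts → Realised t)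

  in-context : ∀ Φ₁ {Φ₂ t ts} → LocallySound t ts →
    All Inv (Φ₁ ++ t ∷ Φ₂) →
    All Inv (Φ₁ ++ ts ++ Φ₂) × (All Realised (Φ₁ ++ ts ++ Φ₂) → All Realised (Φ₁ ++ t ∷ Φ₂))
  in-context Φ₁ {Φ₂} {t} {ts} sound invs with AllP.++⁻ Φ₁ invs
  ... | inv₁ , (inv ∷ inv₂) with sound inv
  ...   | invs' , back = AllP.++⁺ inv₁ (AllP.++⁺ invs' inv₂) , realise
    where
    realise : All Realised (Φ₁ ++ ts ++ Φ₂) → All Realised (Φ₁ ++ t ∷ Φ₂)
    realise rs with AllP.++⁻ Φ₁ rs
    ... | rs₁ , rs₂₃ with AllP.++⁻ ts rs₂₃
    ...   | rs₂ , rs₃ = AllP.++⁺ rs₁ (back rs₂ ∷ rs₃)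

  mu-sound : ∀ {Γ α e T} → LocallySound (Γ , mu α e , T) ((((evar α , T) ∷ Γ) , e , T) ∷ [])
  mu-sound {α = α} (cu-mu c , wΓ , wT) =
    (c , wT ∷ wΓ , wT) ∷ [] ,
    λ { ((e' , d , er) ∷ []) → mu α e' , t-mu d , cong (mu α) er }

  lam-sound : ∀ {Γ e A} ds → LocallySound (Γ , lamsE ds e , arrows (map proj₂ ds) A) ((extend Γ ds , e , A) ∷ [])
  lam-sound {Γ} {e} {A} ds (c , wΓ , wT) with wk-arrows (map proj₂ ds) A wT
  ... | wds , wA =
    (curry-lamsE ds e c , wk-extend Γ ds wΓ wds , wA) ∷ [] ,
    λ { ((e' , d , er) ∷ []) →
          lamsE ds e' , lamsE-typing Γ ds e' A d , trans (erase-lamsE ds e') (cong (lamsE ds) er) }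

  -- Rule (3): the eigenvariables are fresh for Γ and T, so the ∀'s are
  -- reintroduced by type abstraction.
  all-sound : ∀ {Γ e T} Ks xs → length xs ≡ length Ks → Unique xs →
    All (λ x → x ∉ namesCtx Γ × x ∉ names (alls Ks T)) xs →
    LocallySound (Γ , e , alls Ks T) ((Γ , e , instAlls xs (alls Ks T)) ∷ [])
  all-sound {T = T} Ks xs lenx uq fresh (c , wΓ , wT) =
    (c , wΓ , wk-instAlls xs _ wT) ∷ [] ,
    λ { ((e' , d , er) ∷ []) → let (e₀ , d₀ , er₀) = ∀*-intro xs Ks T lenx uq fresh d in e₀ , d₀ , trans er₀ er }

-- Rule (1).  The fixed data of one resolution step with head h : S,
-- S = ∀Ks.body instantiated by fresh xs to Ts ⇒ B, and the matching
-- derivation m of B ↦ A with answer σ.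
module HeadRule {sg : Sig} {Φ₁ Φ₂ : List Triple} {Γ : Ctx} {A : Ty}
  (h : Hd) (es : List Ev) (S : Ty) (Ks : List Kind) (body : Ty)
  (xs : List ℕ) (Ts : List Ty) (B : Ty) (σ : Subst)
  (lk : Γ ∋ h ∶ S) (eqS : S ≡ alls Ks body) (lenx : length xs ≡ length Ks)
  (uq : Unique xs) (frs : All (λ x → x ∉ namesΦ (Φ₁ ++ (Γ , appsE (hdEv h) es , A) ∷ Φ₂)) xs)
  (eqI : instAlls xs S ≡ arrows Ts B) (lenT : length Ts ≡ length es)
  (m : Match sg xs (xs ++ namesΦ (Φ₁ ++ (Γ , appsE (hdEv h) es , A) ∷ Φ₂)) ((B , A) ∷ []) σ)
  where

  used : List ℕ
  used = namesΦ (Φ₁ ++ (Γ , appsE (hdEv h) es , A) ∷ Φ₂)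

  U : List ℕ
  U = xs ++ used

  -- the kind of each matching variable is the kind of its binder in S
  κ : ℕ → Kind
  κ = extendKinds (zip xs Ks) (λ _ → ⋆)

  old-good : ∀ {z K} → z ∈ used → GoodName κ xs U z K
  old-good p = ∈-++⁺ʳ xs p , λ q → ⊥-elim (All.lookup frs q p)

  eigen-good : ∀ {x K} → (x , K) ∈ zip xs Ks → GoodName κ xs U x K
  eigen-good q = ∈-++⁺ˡ (zip-in₁ xs Ks q) , λ _ → sym (extendKinds-∈ (zip xs Ks) _ unique-xs q)
    where
    unique-xs : Unique (map proj₁ (zip xs Ks))
    unique-xs = subst Unique (sym (map-proj₁-zip xs Ks lenx)) uq

  names-S : ∀ {z} → z ∈ names S → z ∈ used
  names-S p = names-in-Φ Φ₁ (∈-++⁺ˡ (names-lookup lk p))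

  names-A : ∀ {z} → z ∈ names A → z ∈ used
  names-A p = names-in-Φ Φ₁ (∈-++⁺ʳ (namesCtx Γ) (∈-++⁺ʳ (namesE (appsE (hdEv h) es)) p))

  good-A : Good κ xs U A
  good-A q = old-good (names-A (fvin-names A q))

  good-instance : Good κ xs U (arrows Ts B)
  good-instance {z} {K} q
    with fvin-instAlls xs Ks body lenx (subst (λ w → FvIn z K (instAlls xs w)) eqS (subst (FvIn z K) (sym eqI) q))
  ... | inj₁ r = old-good (names-S (subst (λ w → z ∈ names w) (sym eqS) (fvin-names _ r)))
  ... | inj₂ r = eigen-good r

  problem-good : All (GoodProblem κ xs U) ((B , A) ∷ [])
  problem-good = (B , A , ε , ε , proj₂ (good-arrows Ts B good-instance) , good-A) ∷ []

  σ-closed : ClosedS σ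
  σ-closed = proj₁ (match-solves m)

  σ-unifies : applyS σ B ↔o* applyS σ A
  σ-unifies with proj₂ (match-solves m)
  ... | s ∷ [] = s

  σ-fixes : ∀ T → (∀ {z} → z ∈ names T → z ∈ used) → applyS σ T ≡ T
  σ-fixes T old = match-fixes m T (λ q → (λ r → All.lookup frs r (old q)) , ∈-++⁺ʳ xs (old q))

  σ-kinding : ∀ {Ψ S'} T → Good κ xs U T → sg ︔ Ψ ⊢ T ∶ S' → sg ︔ Ψ ⊢ applyS σ T ∶ S'
  σ-kinding = match-kinding m κ problem-good

  instances : List Ty
  instances = map (instType σ) (zip xs Ks)

  head-typing : sg ∣ Γ ⊢ tappsE (hdEv h) instances ∶ arrows (map (applyS σ) Ts) (applyS σ B)
  head-typing =
    subst (sg ∣ Γ ⊢ tappsE (hdEv h) instances ∶_)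
      (trans (cong (λ w → applyS σ (instAlls xs w)) (sym eqS)) (trans (cong (applyS σ) eqI) (applyS-arrows σ Ts B)))
      (tapps-typing σ σ-closed xs Ks body (hdEv h) lenx
        (λ {x} {K} q → σ-kinding (fv x K) (λ { here → eigen-good q }) k-fv)
        (subst (sg ∣ Γ ⊢ hdEv h ∶_) (trans (sym (σ-fixes S names-S)) (cong (applyS σ) eqS)) (t-hd lk)))

  premises : List Triple
  premises = map (λ p → (Γ , proj₁ p , applyS σ (proj₂ p))) (zip es Ts)

  premise-invs : All (λ d → WK sg (proj₂ d)) Γ → ∀ es' Ts' → All Curry es' →
    All (λ T → WK sg T × Good κ xs U T) Ts' →
    All (Inv sg) (map (λ p → (Γ , proj₁ p , applyS σ (proj₂ p))) (zip es' Ts'))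
  premise-invs wΓ [] _ _ _ = []
  premise-invs wΓ (_ ∷ _) [] _ _ = []
  premise-invs wΓ (e ∷ es') (T ∷ Ts') (c ∷ cs) (((_ , kT) , gT) ∷ ws) =
    (c , wΓ , _ , σ-kinding T gT kT) ∷ premise-invs wΓ es' Ts' cs ws

  -- h σ(x̲) e₁' ⋯ eₙ' : σB ↔o* A realises h e₁ ⋯ eₙ
  sound : LocallySound sg (Γ , appsE (hdEv h) es , A) premises
  sound (c , wΓ , wA) = premise-invs wΓ es Ts (proj₂ (curry-appsE (hdEv h) es c)) (All.zip (wTs , goodTs)) , realise
    where
    wTs : All (WK sg) Ts
    wTs = proj₁ (wk-arrows Ts B (subst (WK sg) eqI (wk-instAlls xs S (lookup-ctx wΓ lk))))
    goodTs : All (Good κ xs U) Ts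
    goodTs = proj₁ (good-arrows Ts B good-instance)
    realise : All (Realised sg) premises → Realised sg (Γ , appsE (hdEv h) es , A)
    realise rs with collect-realisations σ es Ts lenT (AllP.map⁻ rs)
    ... | es' , ds , ers =
      appsE (tappsE (hdEv h) instances) es' ,
      t-conv (apps-typing _ es' _ _ head-typing ds) (subst (applyS σ B ↔o*_) (σ-fixes A names-A) σ-unifies) wA ,
      trans (erase-appsE _ es') (cong₂ appsE (trans (erase-tappsE (hdEv h) instances) (erase-hd h)) ers)

step-sound : ∀ {sg Φ Φ'} → Step sg Φ Φ' → All (Inv sg) Φ → All (Inv sg) Φ' × (All (Realised sg) Φ' → All (Realised sg) Φ)
step-sound {sg} (r-mu {Φ₁}) = in-context sg Φ₁ (mu-sound sg)
step-sound {sg} (r-lam {Φ₁} ds _ _) = in-context sg Φ₁ (lam-sound sg ds)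
step-sound {sg} (r-all {Φ₁} Ks xs _ lenx (uq , frs)) =
  in-context sg Φ₁ (all-sound sg Ks xs lenx uq (All.map (fresh-in-triple Φ₁) frs))
step-sound {sg} (r-hd {Φ₁} {Φ₂} h es S Ks body xs Ts B σ _ lk eqS lenx (uq , frs) eqI lenT m) =
  in-context sg Φ₁ (HeadRule.sound {Φ₁ = Φ₁} {Φ₂ = Φ₂} h es S Ks body xs Ts B σ lk eqS lenx uq frs eqI lenT m)

rsm-sound : ∀ {sg Φ} → sg ⊢ Φ ⟶* [] → All (Inv sg) Φ → All (Realised sg) Φ
rsm-sound ε invs = []
rsm-sound (s ◅ ss) invs with step-sound s invs
... | invs' , back = back (rsm-sound ss invs')

goodType-wk : ∀ {sg T} → GoodType sg T → WK sg T
goodType-wk ((S , _ , k) , _) = S , k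

theorem32 : (sg : Sig) (Γ : Ctx) (e : Ev) (T : Ty) →
    All (λ d → GoodType sg (proj₂ d)) Γ →
    GoodType sg T →
    Curry e →
    sg ⊢ ((Γ , e , T) ∷ []) ⟶* [] →
    ∃ λ e' → (sg ∣ Γ ⊢ e' ∶ T) × (erase e' ≡ e)
theorem32 sg Γ e T goodΓ goodT curry run =
  All.head (rsm-sound run ((curry , All.map goodType-wk goodΓ , goodType-wk goodT) ∷ []))
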